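{- As formal power series in $q$, $$\sum_{n\geq 0}\overline{R_8^\ast}(2n)q^n=\frac{f_4^6}{f_1^4f_8^2},\qquad \sum_{n\geq 0}\overline{R_8^\ast}(2n+1)q^n=2\frac{f_2^2f_8^2}{f_1^4}.$$
   Context: Here $f_k:=\prod_{i\geq 1}(1-q^{ki})$. An overpartition of $n$ is a partition of $n$ in which the first occurrence of each part size may optionally be overlined. For a positive integer $\ell$, $\overline{R_\ell^\ast}(n)$ denotes the number of overpartitions of $n$ in which no non-overlined part is divisible by $\ell$; its generating function is $\sum_{n\geq 0}\overline{R_\ell^\ast}(n)q^n = \frac{f_2 f_\ell}{f_1^2}$. -}

module Defs where

open import Data.Nat using (ℕ; zero; suc; _∸_; _<ᵇ_; _≡ᵇ_) renaming (_*_ to _*ℕ_)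
open import Data.Integer using (ℤ; +_; -_; _+_; _*_)
open import Data.Bool using (if_then_else_)

-- Formal power series in q with integer coefficients: n ↦ coefficient of q^n.
Series : Set
Series = ℕ → ℤ

sumTo : (ℕ → ℤ) → ℕ → ℤ
sumTo g zero    = g zero
sumTo g (suc n) = sumTo g n + g (suc n)

sumFrom1 : (ℕ → ℤ) → ℕ → ℤ
sumFrom1 g zero    = + 0
sumFrom1 g (suc n) = sumFrom1 g n + g (suc n)

one : Series
one zero    = + 1
one (suc _) = + 0

_⊛_ : Series → Series → Series
(a ⊛ b) n = sumTo (λ k → a k * b (n ∸ k)) n

infixl 7 _⊛_

_^ˢ_ : Series → ℕ → Series
a ^ˢ zero  = one
a ^ˢ suc e = a ⊛ (a ^ˢ e)

infixr 8 _^ˢ_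

scale : ℤ → Series → Series
scale c a n = c * a n

-- Multiplicative inverse of a series with constant term 1:
-- b₀ = 1, b_m = - Σ_{k=1}^{m} a_k b_{m-k}.
-- invUpTo a m agrees with the inverse at all indices < m.
invUpTo : Series → ℕ → Series
invUpTo a zero    = λ _ → + 0
invUpTo a (suc m) = λ j →
  if j <ᵇ m then invUpTo a m j
  else (if m ≡ᵇ 0 then + 1
        else - sumFrom1 (λ k → a k * invUpTo a m (m ∸ k)) m)

inv : Series → Series
inv a n = invUpTo a (suc n) n

oneMinusQ : ℕ → Series
oneMinusQ d n = (if n ≡ᵇ 0 then + 1 else + 0) + (if n ≡ᵇ d then - (+ 1) else + 0)

prodUpTo : ℕ → ℕ → Series
prodUpTo k zero    = one
prodUpTo k (suc N) = prodUpTo k N ⊛ oneMinusQ (k *ℕ suc N)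

-- f_k = ∏_{i≥1} (1 - q^{k i}).  For k ≥ 1 the factors with i > n do not
-- affect the coefficient of q^n, so that coefficient is read off the
-- finite product up to i = n.
f : ℕ → Series
f k n = prodUpTo k n n

Rgf : ℕ → Series
Rgf ℓ = (f 2 ⊛ f ℓ) ⊛ inv (f 1 ^ˢ 2)

Rbar : ℕ → ℕ → ℤ
Rbar ℓ n = Rgf ℓ n

{-# OPTIONS --safe #-}
module Submission where

-- By Gauss, θ(q) = Σ_{n ∈ ℤ} q^(n²) = f₂⁵ / (f₁² f₄²), so f₂ f₈ / f₁² = θ(q) f₄² f₈ / f₂⁴.
-- Splitting θ(q) = θ(q⁴) + 2q ψ(q⁸) by parity, where θ(q⁴) = f₈⁵ / (f₄² f₁₆²) and
-- ψ(q⁸) = Σ_{n ≥ 0} q^(4n(n+1)) = f₁₆² / f₈, gives the even part f₈⁶ / (f₂⁴ f₁₆²) and the odd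
-- part 2q f₄² f₁₆² / f₂⁴, which are the claimed series in q².  Both product formulas are limits
-- of the finite Jacobi triple product
--   Σ_{j ≤ 2N} c^j Q^((j-N)²) [2N choose j]_{Q²} = ∏_{i < N} (Q^(2i+1) + c)(1 + c Q^(2i+1))
-- at c = 1 and c = Q, because [2N choose j]_{Q²} (Q²;Q²)_N² ≡ (Q²;Q²)_N mod Q^(2 min(j, 2N-j) + 2).
-- Equalities of series are proved as agreement below q^M for every M, a ring congruence to
-- which the ring solver applies.

open import Defs
open import Data.Nat using (ℕ; zero; suc; _∸_; _<_; _≤_; _⊓_; ∣_-_∣; z≤n; s≤s; _<ᵇ_; _≡ᵇ_; >-nonZero)
  renaming (_+_ to _+ℕ_; _*_ to _*ℕ_)
import Data.Nat.Properties as ℕ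
open import Data.Nat.Tactic.RingSolver using (solve-∀)
open import Data.Integer using (ℤ; +_; -[1+_]; -_; _+_; _*_; +-*-rawRing; 1ℤ; -1ℤ)
import Data.Integer.Properties as ℤ
open import Data.Integer.Tactic.RingSolver using () renaming (solve-∀ to ℤ-solve-∀)
open import Algebra.Properties.CommutativeSemigroup ℤ.+-commutativeSemigroup using () renaming (interchange to +-interchange)
open import Data.Bool using (true; false; if_then_else_)
open import Data.Maybe using (Maybe; nothing; just)
open import Data.Product using (_×_; _,_)
open import Data.Sum using (inj₁; inj₂)
open import Data.Vec using (Vec; map; allFin)
open import Data.Vec.N-ary using (N-ary; _$ⁿ_)
open import Data.Vec.Relation.Binary.Pointwise.Inductive as Pointwise using (Pointwise; _∷_; [])
open import Function using (_∘_)
open import Relation.Nullary using (yes; no)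
open import Relation.Binary.PropositionalEquality hiding (setoid)
open import Algebra.Bundles using (CommutativeRing)
open import Algebra.Structures using (IsCommutativeRing)
import Algebra.Solver.Ring
import Algebra.Solver.Ring.AlmostCommutativeRing as ACR
import Relation.Binary.Reasoning.Setoid as SetoidReasoning

infixl 6 _+ˢ_

_+ˢ_ : Series → Series → Series
(a +ˢ b) n = a n + b n

-ˢ_ : Series → Series
(-ˢ a) n = - a n

0ˢ : Series
0ˢ _ = + 0

tailˢ : Series → Series
tailˢ a n = a (suc n)

constˢ : ℤ → Series
constˢ c zero    = c
constˢ c (suc _) = + 0

sumTo-cong : ∀ {g h : ℕ → ℤ} n → (∀ k → k ≤ n → g k ≡ h k) → sumTo g n ≡ sumTo h n
sumTo-cong zero    g≡h = g≡h 0 z≤n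
sumTo-cong (suc n) g≡h =
  cong₂ _+_ (sumTo-cong n (λ k k≤n → g≡h k (ℕ.m≤n⇒m≤1+n k≤n))) (g≡h (suc n) ℕ.≤-refl)

sumTo-suc : ∀ (g : ℕ → ℤ) n → sumTo g (suc n) ≡ g 0 + sumTo (λ k → g (suc k)) n
sumTo-suc g zero    = refl
sumTo-suc g (suc n) = trans (cong (_+ g (suc (suc n))) (sumTo-suc g n)) (ℤ.+-assoc (g 0) _ _)

sumTo-+ : ∀ (g h : ℕ → ℤ) n → sumTo (λ k → g k + h k) n ≡ sumTo g n + sumTo h n
sumTo-+ g h zero    = refl
sumTo-+ g h (suc n) = trans (cong (_+ (g (suc n) + h (suc n))) (sumTo-+ g h n))
  (+-interchange (sumTo g n) (sumTo h n) (g (suc n)) (h (suc n)))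

sumTo-*ˡ : ∀ c (g : ℕ → ℤ) n → sumTo (λ k → c * g k) n ≡ c * sumTo g n
sumTo-*ˡ c g zero    = refl
sumTo-*ˡ c g (suc n) =
  trans (cong (_+ c * g (suc n)) (sumTo-*ˡ c g n)) (sym (ℤ.*-distribˡ-+ c (sumTo g n) (g (suc n))))

sumTo-zero : ∀ (g : ℕ → ℤ) n → (∀ k → g k ≡ + 0) → sumTo g n ≡ + 0
sumTo-zero g zero    g≡0 = g≡0 0
sumTo-zero g (suc n) g≡0 = cong₂ _+_ (sumTo-zero g n g≡0) (g≡0 (suc n))

⊛-suc : ∀ a b n → (a ⊛ b) (suc n) ≡ a 0 * b (suc n) + (tailˢ a ⊛ b) n
⊛-suc a b n = sumTo-suc (λ k → a k * b (suc n ∸ k)) n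

⊛-sucʳ : ∀ a b n → (a ⊛ b) (suc n) ≡ (a ⊛ tailˢ b) n + a (suc n) * b 0
⊛-sucʳ a b n = cong₂ _+_
  (sumTo-cong n (λ k k≤n → cong (λ m → a k * b m) (ℕ.+-∸-assoc 1 k≤n)))
  (cong (λ m → a (suc n) * b m) (ℕ.n∸n≡0 n))

⊛-congˡ-upTo : ∀ {a a′} b n → (∀ k → k ≤ n → a k ≡ a′ k) → (a ⊛ b) n ≡ (a′ ⊛ b) n
⊛-congˡ-upTo b n a≡a′ = sumTo-cong n (λ k k≤n → cong (_* b (n ∸ k)) (a≡a′ k k≤n))

⊛-comm : ∀ a b → a ⊛ b ≗ b ⊛ a
⊛-comm a b zero    = ℤ.*-comm (a 0) (b 0)
⊛-comm a b (suc n) = begin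
  (a ⊛ b) (suc n)                         ≡⟨ ⊛-suc a b n ⟩
  a 0 * b (suc n) + (tailˢ a ⊛ b) n       ≡⟨ cong₂ _+_ (ℤ.*-comm (a 0) (b (suc n))) (⊛-comm (tailˢ a) b n) ⟩
  b (suc n) * a 0 + (b ⊛ tailˢ a) n       ≡⟨ ℤ.+-comm (b (suc n) * a 0) _ ⟩
  (b ⊛ tailˢ a) n + b (suc n) * a 0       ≡⟨ sym (⊛-sucʳ b a n) ⟩
  (b ⊛ a) (suc n)                         ∎
  where open ≡-Reasoning

⊛-distribʳ-+ : ∀ a b c → (a +ˢ b) ⊛ c ≗ a ⊛ c +ˢ b ⊛ c
⊛-distribʳ-+ a b c n =
  trans (sumTo-cong n (λ k _ → ℤ.*-distribʳ-+ (c (n ∸ k)) (a k) (b k))) (sumTo-+ _ _ n)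

⊛-distribˡ-+ : ∀ a b c → a ⊛ (b +ˢ c) ≗ a ⊛ b +ˢ a ⊛ c
⊛-distribˡ-+ a b c n = trans (⊛-comm a (b +ˢ c) n)
  (trans (⊛-distribʳ-+ b c a n) (cong₂ _+_ (⊛-comm b a n) (⊛-comm c a n)))

⊛-scaleˡ : ∀ x a c → scale x a ⊛ c ≗ scale x (a ⊛ c)
⊛-scaleˡ x a c n = trans (sumTo-cong n (λ k _ → ℤ.*-assoc x (a k) _)) (sumTo-*ˡ x _ n)

⊛-assoc : ∀ a b c → (a ⊛ b) ⊛ c ≗ a ⊛ (b ⊛ c)
⊛-assoc a b c zero    = ℤ.*-assoc (a 0) (b 0) (c 0)
⊛-assoc a b c (suc n) = begin
  ((a ⊛ b) ⊛ c) (suc n)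
    ≡⟨ ⊛-suc (a ⊛ b) c n ⟩
  a₀b₀ * c (suc n) + (tailˢ (a ⊛ b) ⊛ c) n
    ≡⟨ cong (λ u → a₀b₀ * c (suc n) + u) (⊛-congˡ-upTo c n (λ k _ → ⊛-suc a b k)) ⟩
  a₀b₀ * c (suc n) + ((scale (a 0) (tailˢ b) +ˢ tailˢ a ⊛ b) ⊛ c) n
    ≡⟨ cong (λ u → a₀b₀ * c (suc n) + u) (⊛-distribʳ-+ (scale (a 0) (tailˢ b)) (tailˢ a ⊛ b) c n) ⟩
  a₀b₀ * c (suc n) + ((scale (a 0) (tailˢ b) ⊛ c) n + ((tailˢ a ⊛ b) ⊛ c) n)
    ≡⟨ cong₂ (λ u v → a₀b₀ * c (suc n) + (u + v)) (⊛-scaleˡ (a 0) (tailˢ b) c n) (⊛-assoc (tailˢ a) b c n) ⟩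
  a₀b₀ * c (suc n) + (a 0 * (tailˢ b ⊛ c) n + (tailˢ a ⊛ (b ⊛ c)) n)
    ≡⟨ regroup (a 0) (b 0) (c (suc n)) ((tailˢ b ⊛ c) n) ((tailˢ a ⊛ (b ⊛ c)) n) ⟩
  a 0 * (b 0 * c (suc n) + (tailˢ b ⊛ c) n) + (tailˢ a ⊛ (b ⊛ c)) n
    ≡⟨ cong (λ u → a 0 * u + (tailˢ a ⊛ (b ⊛ c)) n) (sym (⊛-suc b c n)) ⟩
  a 0 * (b ⊛ c) (suc n) + (tailˢ a ⊛ (b ⊛ c)) n
    ≡⟨ sym (⊛-suc a (b ⊛ c) n) ⟩
  (a ⊛ (b ⊛ c)) (suc n) ∎
  where
  open ≡-Reasoning
  a₀b₀ = a 0 * b 0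
  regroup : ∀ x y z u v → (x * y) * z + (x * u + v) ≡ x * (y * z + u) + v
  regroup = ℤ-solve-∀

⊛-zeroˡ : ∀ a → 0ˢ ⊛ a ≗ 0ˢ
⊛-zeroˡ a n = sumTo-zero _ n (λ _ → refl)

⊛-identityˡ : ∀ a → one ⊛ a ≗ a
⊛-identityˡ a zero    = ℤ.*-identityˡ (a 0)
⊛-identityˡ a (suc n) = begin
  (one ⊛ a) (suc n)                      ≡⟨ ⊛-suc one a n ⟩
  + 1 * a (suc n) + (tailˢ one ⊛ a) n    ≡⟨ cong₂ _+_ (ℤ.*-identityˡ (a (suc n))) (⊛-zeroˡ a n) ⟩
  a (suc n) + + 0                        ≡⟨ ℤ.+-identityʳ _ ⟩
  a (suc n)                              ∎
  where open ≡-Reasoning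

⊛-identityʳ : ∀ a → a ⊛ one ≗ a
⊛-identityʳ a n = trans (⊛-comm a one n) (⊛-identityˡ a n)

⊛-congʳ : ∀ a {b b′} → b ≗ b′ → a ⊛ b ≗ a ⊛ b′
⊛-congʳ a b≗b′ n = sumTo-cong n (λ k _ → cong (a k *_) (b≗b′ (n ∸ k)))

⊛-congˡ : ∀ {a a′} b → a ≗ a′ → a ⊛ b ≗ a′ ⊛ b
⊛-congˡ b a≗a′ n = ⊛-congˡ-upTo b n (λ k _ → a≗a′ k)

⊛-vanishʳ : ∀ a {b} → b ≗ 0ˢ → a ⊛ b ≗ 0ˢ
⊛-vanishʳ a b≗0 n = sumTo-zero _ n (λ k → trans (cong (a k *_) (b≗0 (n ∸ k))) (ℤ.*-zeroʳ (a k)))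

constˢ-⊛ : ∀ c a → constˢ c ⊛ a ≗ scale c a
constˢ-⊛ c a zero    = refl
constˢ-⊛ c a (suc n) =
  trans (⊛-suc (constˢ c) a n) (trans (cong (λ u → c * a (suc n) + u) (⊛-zeroˡ a n)) (ℤ.+-identityʳ _))

infix 4 _≈[_]_

_≈[_]_ : Series → ℕ → Series → Set
a ≈[ M ] b = ∀ n → n < M → a n ≡ b n

≈-refl : ∀ {a M} → a ≈[ M ] a
≈-refl _ _ = refl

≈-sym : ∀ {M a b} → a ≈[ M ] b → b ≈[ M ] a
≈-sym a≈b n n<M = sym (a≈b n n<M)

≈-trans : ∀ {M a b c} → a ≈[ M ] b → b ≈[ M ] c → a ≈[ M ] c
≈-trans a≈b b≈c n n<M = trans (a≈b n n<M) (b≈c n n<M)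

≈-lower : ∀ {M M′ a b} → M′ ≤ M → a ≈[ M ] b → a ≈[ M′ ] b
≈-lower M′≤M a≈b n n<M′ = a≈b n (ℕ.<-≤-trans n<M′ M′≤M)

≗⇒≈ : ∀ {M a b} → a ≗ b → a ≈[ M ] b
≗⇒≈ a≗b n _ = a≗b n

≡⇒≈ : ∀ {M} {A : Set} (s : A → Series) {x y} → x ≡ y → s x ≈[ M ] s y
≡⇒≈ s refl = ≈-refl

⊛-cong : ∀ {M a a′ b b′} → a ≈[ M ] a′ → b ≈[ M ] b′ → a ⊛ b ≈[ M ] a′ ⊛ b′
⊛-cong a≈a′ b≈b′ n n<M = sumTo-cong n (λ k k≤n →
  cong₂ _*_ (a≈a′ k (ℕ.≤-<-trans k≤n n<M)) (b≈b′ (n ∸ k) (ℕ.≤-<-trans (ℕ.m∸n≤m n k) n<M)))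

-- The embedding ℤ → Series handed to the ring solver: it sends 1 to `one` itself,
-- so that the solver's normal forms mention `one` literally.
ι : ℤ → Series
ι (+ 1) = one
ι c     = constˢ c

ι≗constˢ : ∀ c → ι c ≗ constˢ c
ι≗constˢ (+ 0)           n       = refl
ι≗constˢ (+ 1)           zero    = refl
ι≗constˢ (+ 1)           (suc n) = refl
ι≗constˢ (+ suc (suc m)) n       = refl
ι≗constˢ -[1+ m ]        n       = refl

0ˢ≗ι0 : 0ˢ ≗ ι (+ 0)
0ˢ≗ι0 zero    = refl
0ˢ≗ι0 (suc n) = refl

oneMinus : Series → Series
oneMinus a = one +ˢ ι -1ℤ ⊛ a

ι-⊛ : ∀ c a → ι c ⊛ a ≗ scale c a
ι-⊛ c a n = trans (⊛-congˡ-upTo a n (λ k _ → ι≗constˢ c k)) (constˢ-⊛ c a n)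

module Truncated (M : ℕ) where

  infix 4 _≈_

  _≈_ : Series → Series → Set
  a ≈ b = a ≈[ M ] b

  isCommutativeRing : IsCommutativeRing _≈_ _+ˢ_ _⊛_ -ˢ_ 0ˢ one
  isCommutativeRing = record
    { isRing = record
      { +-isAbelianGroup = record
        { isGroup = record
          { isMonoid = record
            { isSemigroup = record
              { isMagma = record
                { isEquivalence = record { refl = ≈-refl ; sym = ≈-sym ; trans = ≈-trans }
                ; ∙-cong = λ a≈a′ b≈b′ n n<M → cong₂ _+_ (a≈a′ n n<M) (b≈b′ n n<M) }
              ; assoc = λ a b c n _ → ℤ.+-assoc (a n) (b n) (c n) }
            ; identity = (λ a n _ → ℤ.+-identityˡ (a n)) , (λ a n _ → ℤ.+-identityʳ (a n)) }
          ; inverse = (λ a n _ → ℤ.+-inverseˡ (a n)) , (λ a n _ → ℤ.+-inverseʳ (a n))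
          ; ⁻¹-cong = λ a≈b n n<M → cong -_ (a≈b n n<M) }
        ; comm = λ a b n _ → ℤ.+-comm (a n) (b n) }
      ; *-cong = ⊛-cong
      ; *-assoc = λ a b c → ≗⇒≈ (⊛-assoc a b c)
      ; *-identity = (λ a → ≗⇒≈ (⊛-identityˡ a)) , (λ a → ≗⇒≈ (⊛-identityʳ a))
      ; distrib = (λ a b c → ≗⇒≈ (⊛-distribˡ-+ a b c)) , (λ a b c → ≗⇒≈ (⊛-distribʳ-+ b c a)) }
    ; *-comm = λ a b → ≗⇒≈ (⊛-comm a b) }

  commutativeRing : CommutativeRing _ _
  commutativeRing = record { isCommutativeRing = isCommutativeRing }

  open CommutativeRing commutativeRing public using (setoid; +-cong)
  module ≈-Reasoning = SetoidReasoning setoid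

  private
    almostCommutativeRing : ACR.AlmostCommutativeRing _ _
    almostCommutativeRing = ACR.fromCommutativeRing commutativeRing

    ι-homomorphism : ACR._-Raw-AlmostCommutative⟶_ +-*-rawRing almostCommutativeRing
    ι-homomorphism = record
      { ⟦_⟧    = ι
      ; +-homo = λ a b → via (λ n → +-homo a b n)
      ; *-homo = λ a b → ≈-trans (via (λ n → *-homo a b n)) (⊛-cong (≗⇒≈ (sym ∘ ι≗constˢ a)) (≗⇒≈ (sym ∘ ι≗constˢ b)))
      ; -‿homo = λ a → via (λ n → -‿homo a n)
      ; 0-homo = λ { zero _ → refl ; (suc _) _ → refl }
      ; 1-homo = λ { zero _ → refl ; (suc _) _ → refl } }
      where
      via : ∀ {c x} → constˢ c ≗ x → ι c ≈ x
      via {c} eq n _ = trans (ι≗constˢ c n) (eq n)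
      +-homo : ∀ a b → constˢ (a + b) ≗ ι a +ˢ ι b
      +-homo a b zero    = sym (cong₂ _+_ (ι≗constˢ a 0) (ι≗constˢ b 0))
      +-homo a b (suc n) = sym (cong₂ _+_ (ι≗constˢ a (suc n)) (ι≗constˢ b (suc n)))
      *-homo : ∀ a b → constˢ (a * b) ≗ constˢ a ⊛ constˢ b
      *-homo a b zero    = refl
      *-homo a b (suc n) = sym (trans (constˢ-⊛ a (constˢ b) (suc n)) (ℤ.*-zeroʳ a))
      -‿homo : ∀ a → constˢ (- a) ≗ -ˢ ι a
      -‿homo a zero    = sym (cong -_ (ι≗constˢ a 0))
      -‿homo a (suc n) = sym (cong -_ (ι≗constˢ a (suc n)))

    ι-equal? : ∀ (a b : ℤ) → Maybe (ι a ≈ ι b)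
    ι-equal? a b with a ℤ.≟ b
    ... | yes refl = just ≈-refl
    ... | no _     = nothing

  open Algebra.Solver.Ring +-*-rawRing almostCommutativeRing ι-homomorphism ι-equal? public

  ⟦⟧-cong : ∀ {k} (p : Polynomial k) {ρ ρ′ : Vec Series k} → Pointwise _≈_ ρ ρ′ → ⟦ p ⟧ ρ ≈ ⟦ p ⟧ ρ′
  ⟦⟧-cong (op [+] p₁ p₂) ρ≈ρ′ = +-cong (⟦⟧-cong p₁ ρ≈ρ′) (⟦⟧-cong p₂ ρ≈ρ′)
  ⟦⟧-cong (op [*] p₁ p₂) ρ≈ρ′ = ⊛-cong (⟦⟧-cong p₁ ρ≈ρ′) (⟦⟧-cong p₂ ρ≈ρ′)
  ⟦⟧-cong (con c)        ρ≈ρ′ = ≈-refl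
  ⟦⟧-cong (var x)        ρ≈ρ′ = Pointwise.lookup ρ≈ρ′ x
  ⟦⟧-cong (p :^ zero)    ρ≈ρ′ = ≈-refl
  ⟦⟧-cong (p :^ suc m)   ρ≈ρ′ = ⊛-cong (⟦⟧-cong p ρ≈ρ′) (⟦⟧-cong (p :^ m) ρ≈ρ′)
  ⟦⟧-cong (:- p)         ρ≈ρ′ = λ n n<M → cong -_ (⟦⟧-cong p ρ≈ρ′ n n<M)

  :0 :1 : ∀ {k} → Polynomial k
  :0 = con (+ 0)
  :1 = con 1ℤ

  1-_ : ∀ {k} → Polynomial k → Polynomial k
  1- x = :1 :+ con -1ℤ :* x

  substitute : ∀ k (f : N-ary k (Polynomial k) (Polynomial k)) {ρ ρ′ : Vec Series k} → Pointwise _≈_ ρ ρ′ →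
               ⟦ f $ⁿ map var (allFin k) ⟧ ρ ≈ ⟦ f $ⁿ map var (allFin k) ⟧ ρ′
  substitute k f = ⟦⟧-cong (f $ⁿ map var (allFin k))

^ˢ-congˡ : ∀ {a b} → a ≗ b → ∀ e → a ^ˢ e ≗ b ^ˢ e
^ˢ-congˡ         a≗b zero    n = refl
^ˢ-congˡ {a} {b} a≗b (suc e) n = trans (⊛-congˡ (a ^ˢ e) a≗b n) (⊛-congʳ b (^ˢ-congˡ a≗b e) n)

^ˢ-+ : ∀ a m n → a ^ˢ (m +ℕ n) ≗ a ^ˢ m ⊛ a ^ˢ n
^ˢ-+ a zero    n k = sym (⊛-identityˡ (a ^ˢ n) k)
^ˢ-+ a (suc m) n k =
  trans (⊛-congʳ a (^ˢ-+ a m n) k) (sym (⊛-assoc a (a ^ˢ m) (a ^ˢ n) k))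

^ˢ-* : ∀ a m n → a ^ˢ (m *ℕ n) ≗ (a ^ˢ m) ^ˢ n
^ˢ-* a m zero    k rewrite ℕ.*-zeroʳ m = refl
^ˢ-* a m (suc n) k rewrite ℕ.*-suc m n =
  trans (^ˢ-+ a m (m *ℕ n) k) (⊛-congʳ (a ^ˢ m) (^ˢ-* a m n) k)

q : Series
q zero          = + 0
q (suc zero)    = + 1
q (suc (suc _)) = + 0

q⊛-suc : ∀ a n → (q ⊛ a) (suc n) ≡ a n
q⊛-suc a n = begin
  (q ⊛ a) (suc n)                  ≡⟨ ⊛-suc q a n ⟩
  + 0 * a (suc n) + (tailˢ q ⊛ a) n ≡⟨ cong (λ u → + 0 * a (suc n) + u) (⊛-congˡ-upTo a n tailˢq≡one) ⟩
  + 0 + (one ⊛ a) n                ≡⟨ ℤ.+-identityˡ _ ⟩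
  (one ⊛ a) n                      ≡⟨ ⊛-identityˡ a n ⟩
  a n                              ∎
  where
  open ≡-Reasoning
  tailˢq≡one : ∀ k → k ≤ n → tailˢ q k ≡ one k
  tailˢq≡one zero    _ = refl
  tailˢq≡one (suc k) _ = refl

q^⊛-shift : ∀ e a n → (q ^ˢ e ⊛ a) (e +ℕ n) ≡ a n
q^⊛-shift zero    a n = ⊛-identityˡ a n
q^⊛-shift (suc e) a n =
  trans (⊛-assoc q (q ^ˢ e) a (suc (e +ℕ n))) (trans (q⊛-suc (q ^ˢ e ⊛ a) (e +ℕ n)) (q^⊛-shift e a n))

q^⊛-below : ∀ e a n → n < e → (q ^ˢ e ⊛ a) n ≡ + 0
q^⊛-below (suc e) a zero    _         = ⊛-assoc q (q ^ˢ e) a 0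
q^⊛-below (suc e) a (suc n) (s≤s n<e) =
  trans (⊛-assoc q (q ^ˢ e) a (suc n)) (trans (q⊛-suc (q ^ˢ e ⊛ a) n) (q^⊛-below e a n n<e))

q^⊛-cong : ∀ e {M a b} → a ≈[ M ] b → q ^ˢ e ⊛ a ≈[ e +ℕ M ] q ^ˢ e ⊛ b
q^⊛-cong e {M} {a} {b} a≈b n n<e+M with n ℕ.<? e
... | yes n<e = trans (q^⊛-below e a n n<e) (sym (q^⊛-below e b n n<e))
... | no  n≮e = begin
  (q ^ˢ e ⊛ a) n             ≡⟨ cong (q ^ˢ e ⊛ a) (sym e+[n∸e]≡n) ⟩
  (q ^ˢ e ⊛ a) (e +ℕ (n ∸ e)) ≡⟨ q^⊛-shift e a (n ∸ e) ⟩
  a (n ∸ e)                  ≡⟨ a≈b (n ∸ e) n∸e<M ⟩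
  b (n ∸ e)                  ≡⟨ sym (q^⊛-shift e b (n ∸ e)) ⟩
  (q ^ˢ e ⊛ b) (e +ℕ (n ∸ e)) ≡⟨ cong (q ^ˢ e ⊛ b) e+[n∸e]≡n ⟩
  (q ^ˢ e ⊛ b) n             ∎
  where
  open ≡-Reasoning
  e+[n∸e]≡n = ℕ.m+[n∸m]≡n (ℕ.≮⇒≥ n≮e)
  n∸e<M = ℕ.+-cancelˡ-< e (n ∸ e) M (subst (_< e +ℕ M) (sym e+[n∸e]≡n) n<e+M)

q^⊛-cancel : ∀ e {M a b} → q ^ˢ e ⊛ a ≈[ e +ℕ M ] q ^ˢ e ⊛ b → a ≈[ M ] b
q^⊛-cancel e {a = a} {b} eq n n<M =
  trans (sym (q^⊛-shift e a n)) (trans (eq (e +ℕ n) (ℕ.+-monoʳ-< e n<M)) (q^⊛-shift e b n))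

q^≈0ˢ : ∀ e → q ^ˢ e ≈[ e ] 0ˢ
q^≈0ˢ e n n<e = trans (sym (⊛-identityʳ (q ^ˢ e) n)) (q^⊛-below e one n n<e)

q^-coeff : ∀ d n → (q ^ˢ d) n ≡ (if n ≡ᵇ d then + 1 else + 0)
q^-coeff zero    zero    = refl
q^-coeff zero    (suc n) = refl
q^-coeff (suc d) zero    = refl
q^-coeff (suc d) (suc n) = trans (q⊛-suc (q ^ˢ d) n) (q^-coeff d n)

sumTo≡head+sumFrom1 : ∀ (g : ℕ → ℤ) n → sumTo g n ≡ g 0 + sumFrom1 g n
sumTo≡head+sumFrom1 g zero    = sym (ℤ.+-identityʳ (g 0))
sumTo≡head+sumFrom1 g (suc n) =
  trans (cong (_+ g (suc n)) (sumTo≡head+sumFrom1 g n)) (ℤ.+-assoc (g 0) _ _)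

sumFrom1-cong : ∀ {g h : ℕ → ℤ} n → (∀ k → 1 ≤ k → k ≤ n → g k ≡ h k) → sumFrom1 g n ≡ sumFrom1 h n
sumFrom1-cong zero    g≡h = refl
sumFrom1-cong (suc n) g≡h = cong₂ _+_
  (sumFrom1-cong n (λ k 1≤k k≤n → g≡h k 1≤k (ℕ.m≤n⇒m≤1+n k≤n)))
  (g≡h (suc n) (s≤s z≤n) ℕ.≤-refl)

invUpTo-stable : ∀ a m j → j < m → invUpTo a m j ≡ inv a j
invUpTo-stable a (suc m) j (s≤s j≤m) with ℕ.m≤n⇒m<n∨m≡n j≤m
... | inj₂ refl = refl
... | inj₁ j<m with j <ᵇ m | ℕ.<⇒<ᵇ j<m
...   | true | _ = invUpTo-stable a m j j<m

n<ᵇn : ∀ n → (n <ᵇ n) ≡ false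
n<ᵇn zero    = refl
n<ᵇn (suc n) = n<ᵇn n

inv-suc : ∀ a m → inv a (suc m) ≡ - sumFrom1 (λ k → a k * inv a (suc m ∸ k)) (suc m)
inv-suc a m rewrite n<ᵇn m = cong -_ (sumFrom1-cong (suc m) (λ k 1≤k k≤1+m →
  cong (a k *_) (invUpTo-stable a (suc m) (suc m ∸ k) (ℕ.∸-monoʳ-< {o = 0} 1≤k k≤1+m))))

⊛-inverseʳ : ∀ a → a 0 ≡ 1ℤ → a ⊛ inv a ≗ one
⊛-inverseʳ a a₀≡1 zero    rewrite a₀≡1 = refl
⊛-inverseʳ a a₀≡1 (suc m) = begin
  (a ⊛ inv a) (suc m)                            ≡⟨ sumTo≡head+sumFrom1 _ (suc m) ⟩
  a 0 * inv a (suc m) + S                        ≡⟨ cong (_+ S) (cong₂ _*_ a₀≡1 (inv-suc a m)) ⟩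
  1ℤ * - S + S                                   ≡⟨ cong (_+ S) (ℤ.*-identityˡ (- S)) ⟩
  - S + S                                        ≡⟨ ℤ.+-inverseˡ S ⟩
  one (suc m)                                    ∎
  where
  open ≡-Reasoning
  S = sumFrom1 (λ k → a k * inv a (suc m ∸ k)) (suc m)

⊛-inverseˡ : ∀ a → a 0 ≡ 1ℤ → inv a ⊛ a ≗ one
⊛-inverseˡ a a₀≡1 n = trans (⊛-comm (inv a) a n) (⊛-inverseʳ a a₀≡1 n)

⊛-cancelʳ : ∀ {M a b} u → u 0 ≡ 1ℤ → a ⊛ u ≈[ M ] b ⊛ u → a ≈[ M ] b
⊛-cancelʳ {M} {a} {b} u u₀≡1 au≈bu = begin
  a                 ≈⟨ ≗⇒≈ (λ n → sym (⊛-identityʳ a n)) ⟩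
  a ⊛ one           ≈⟨ ≗⇒≈ (⊛-congʳ a (λ n → sym (⊛-inverseʳ u u₀≡1 n))) ⟩
  a ⊛ (u ⊛ inv u)   ≈⟨ ≗⇒≈ (λ n → sym (⊛-assoc a u (inv u) n)) ⟩
  (a ⊛ u) ⊛ inv u   ≈⟨ ⊛-cong {b = inv u} au≈bu ≈-refl ⟩
  (b ⊛ u) ⊛ inv u   ≈⟨ ≗⇒≈ (⊛-assoc b u (inv u)) ⟩
  b ⊛ (u ⊛ inv u)   ≈⟨ ≗⇒≈ (⊛-congʳ b (⊛-inverseʳ u u₀≡1)) ⟩
  b ⊛ one           ≈⟨ ≗⇒≈ (⊛-identityʳ b) ⟩
  b                 ∎
  where open Truncated.≈-Reasoning M

factor : ℤ → ℕ → Series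
factor σ e = one +ˢ ι σ ⊛ q ^ˢ e

-- poch σ b s N = ∏_{i<N} (1 + σ q^(b + s i)); for σ = ∓1 this is (±q^b; q^s)_N.
poch : ℤ → ℕ → ℕ → ℕ → Series
poch σ b s zero    = one
poch σ b s (suc N) = poch σ b s N ⊛ factor σ (b +ℕ s *ℕ N)

⊛-identityʳ-≈ : ∀ {M u} a → u ≈[ M ] one → a ⊛ u ≈[ M ] a
⊛-identityʳ-≈ {u = u} a u≈1 = ≈-trans (⊛-cong {a = a} {a′ = a} {b = u} ≈-refl u≈1) (≗⇒≈ (⊛-identityʳ a))

factor≈one : ∀ σ e → factor σ e ≈[ e ] one
factor≈one σ e n n<e = trans
  (cong (λ u → one n + u) (trans (⊛-comm (ι σ) (q ^ˢ e) n) (q^⊛-below e (ι σ) n n<e)))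
  (ℤ.+-identityʳ (one n))

poch-stable : ∀ σ b s {m N} → m ≤ N → poch σ b s N ≈[ b +ℕ s *ℕ m ] poch σ b s m
poch-stable σ b s {N = zero}  z≤n   = ≈-refl
poch-stable σ b s {N = suc N} m≤1+N with ℕ.m≤n⇒m<n∨m≡n m≤1+N
... | inj₂ refl      = ≈-refl
... | inj₁ (s≤s m≤N) = ≈-trans
  (≈-lower (ℕ.+-monoʳ-≤ b (ℕ.*-monoʳ-≤ s m≤N)) (⊛-identityʳ-≈ (poch σ b s N) (factor≈one σ _)))
  (poch-stable σ b s m≤N)

oneMinusQ≗factor : ∀ d → oneMinusQ d ≗ factor -1ℤ d
oneMinusQ≗factor d n = cong₂ _+_ (constant-term n)
  (trans (negate-indicator (n ≡ᵇ d)) (sym (trans (ι-⊛ -1ℤ (q ^ˢ d) n) (cong (-1ℤ *_) (q^-coeff d n)))))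
  where
  constant-term : ∀ n → (if n ≡ᵇ 0 then + 1 else + 0) ≡ one n
  constant-term zero    = refl
  constant-term (suc n) = refl
  negate-indicator : ∀ b → (if b then -1ℤ else + 0) ≡ -1ℤ * (if b then + 1 else + 0)
  negate-indicator true  = refl
  negate-indicator false = refl

prodUpTo≗poch : ∀ k N → prodUpTo k N ≗ poch -1ℤ k k N
prodUpTo≗poch k zero    n = refl
prodUpTo≗poch k (suc N) n = trans
  (⊛-congˡ (oneMinusQ (k *ℕ suc N)) (prodUpTo≗poch k N) n)
  (⊛-congʳ (poch -1ℤ k k N) (λ m → trans (cong (λ e → oneMinusQ e m) (ℕ.*-suc k N)) (oneMinusQ≗factor _ m)) n)

-- f k n is read off the product up to i = n; both that product and the one up to
-- i = N agree with the product up to i = n ⊓ N below the precision k (1 + n ⊓ N) > n.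
f≈poch : ∀ k N → 1 ≤ k → f k ≈[ k *ℕ suc N ] poch -1ℤ k k N
f≈poch k N 1≤k n n<k[1+N] = begin
  f k n                       ≡⟨ prodUpTo≗poch k n n ⟩
  poch -1ℤ k k n n            ≡⟨ poch-stable -1ℤ k k (ℕ.m⊓n≤m n N) n n<precision ⟩
  poch -1ℤ k k (n ⊓ N) n      ≡⟨ sym (poch-stable -1ℤ k k (ℕ.m⊓n≤n n N) n n<precision) ⟩
  poch -1ℤ k k N n            ∎
  where
  open ≡-Reasoning
  instance _ = >-nonZero 1≤k
  n<precision : n < k +ℕ k *ℕ (n ⊓ N)
  n<precision = subst (n <_) (trans (sym (ℕ.*-distribˡ-⊓ k (suc n) (suc N))) (ℕ.*-suc k (n ⊓ N)))
    (ℕ.⊓-glb (ℕ.m≤n*m (suc n) k) n<k[1+N])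

dilate : Series → Series
dilate a zero          = a 0
dilate a (suc zero)    = + 0
dilate a (suc (suc n)) = dilate (tailˢ a) n

dilate-even : ∀ a n → dilate a (2 *ℕ n) ≡ a n
dilate-even a zero    = refl
dilate-even a (suc n) rewrite ℕ.*-suc 2 n = dilate-even (tailˢ a) n

dilate-odd : ∀ a n → dilate a (suc (2 *ℕ n)) ≡ + 0
dilate-odd a zero    = refl
dilate-odd a (suc n) =
  subst (λ m → dilate a (suc m) ≡ + 0) (sym (ℕ.*-suc 2 n)) (dilate-odd (tailˢ a) n)

dilate-cong : ∀ {a b} → a ≗ b → dilate a ≗ dilate b
dilate-cong a≗b zero          = a≗b 0
dilate-cong a≗b (suc zero)    = refl
dilate-cong a≗b (suc (suc n)) = dilate-cong (λ m → a≗b (suc m)) n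

dilate-≈ : ∀ {M a b} → a ≈[ M ] b → dilate a ≈[ M +ℕ M ] dilate b
dilate-≈ {suc M} a≈b zero          _             = a≈b 0 (s≤s z≤n)
dilate-≈         a≈b (suc zero)    _             = refl
dilate-≈ {suc M} a≈b (suc (suc n)) (s≤s 2+n<2+2M) =
  dilate-≈ {M} (λ m m<M → a≈b (suc m) (s≤s m<M)) n
    (ℕ.≤-pred (subst (suc (suc n) ≤_) (ℕ.+-suc M M) 2+n<2+2M))

dilate-+ : ∀ a b → dilate (a +ˢ b) ≗ dilate a +ˢ dilate b
dilate-+ a b zero          = refl
dilate-+ a b (suc zero)    = refl
dilate-+ a b (suc (suc n)) = dilate-+ (tailˢ a) (tailˢ b) n

dilate-scale : ∀ c a → dilate (scale c a) ≗ scale c (dilate a)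
dilate-scale c a zero          = refl
dilate-scale c a (suc zero)    = sym (ℤ.*-zeroʳ c)
dilate-scale c a (suc (suc n)) = dilate-scale c (tailˢ a) n

dilate-⊛ : ∀ a b → dilate (a ⊛ b) ≗ dilate a ⊛ dilate b
dilate-⊛ a b zero          = refl
dilate-⊛ a b (suc zero)    = sym (cong₂ _+_ (ℤ.*-zeroʳ (a 0)) (ℤ.*-zeroˡ (b 0)))
dilate-⊛ a b (suc (suc n)) = begin
  dilate (tailˢ (a ⊛ b)) n
    ≡⟨ dilate-cong (⊛-suc a b) n ⟩
  dilate (scale (a 0) (tailˢ b) +ˢ tailˢ a ⊛ b) n
    ≡⟨ dilate-+ _ _ n ⟩
  dilate (scale (a 0) (tailˢ b)) n + dilate (tailˢ a ⊛ b) n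
    ≡⟨ cong₂ _+_ (dilate-scale (a 0) (tailˢ b) n) (dilate-⊛ (tailˢ a) b n) ⟩
  a 0 * dilate (tailˢ b) n + (dilate (tailˢ a) ⊛ dilate b) n
    ≡⟨ cong (λ u → a 0 * dilate (tailˢ b) n + u) (sym (trans
         (cong (_+ (dilate (tailˢ a) ⊛ dilate b) n) (ℤ.*-zeroˡ (dilate b (suc n)))) (ℤ.+-identityˡ _))) ⟩
  a 0 * dilate (tailˢ b) n + (+ 0 * dilate b (suc n) + (dilate (tailˢ a) ⊛ dilate b) n)
    ≡⟨ cong (λ u → a 0 * dilate (tailˢ b) n + u) (sym (⊛-suc (tailˢ (dilate a)) (dilate b) n)) ⟩
  a 0 * dilate (tailˢ b) n + (tailˢ (dilate a) ⊛ dilate b) (suc n)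
    ≡⟨ sym (⊛-suc (dilate a) (dilate b) (suc n)) ⟩
  (dilate a ⊛ dilate b) (suc (suc n)) ∎
  where open ≡-Reasoning

dilate-0ˢ : dilate 0ˢ ≗ 0ˢ
dilate-0ˢ zero          = refl
dilate-0ˢ (suc zero)    = refl
dilate-0ˢ (suc (suc n)) = dilate-0ˢ n

dilate-one : dilate one ≗ one
dilate-one zero          = refl
dilate-one (suc zero)    = refl
dilate-one (suc (suc n)) = dilate-0ˢ n

dilate-^ˢ : ∀ a e → dilate (a ^ˢ e) ≗ dilate a ^ˢ e
dilate-^ˢ a zero    = dilate-one
dilate-^ˢ a (suc e) n = trans (dilate-⊛ a (a ^ˢ e) n) (⊛-congʳ (dilate a) (dilate-^ˢ a e) n)

dilate-q^ : ∀ e → dilate (q ^ˢ e) ≗ q ^ˢ (e +ℕ e)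
dilate-q^ e n = begin
  dilate (q ^ˢ e) n      ≡⟨ dilate-^ˢ q e n ⟩
  (dilate q ^ˢ e) n      ≡⟨ ^ˢ-congˡ dilate-q e n ⟩
  ((q ^ˢ 2) ^ˢ e) n      ≡⟨ sym (^ˢ-* q 2 e n) ⟩
  (q ^ˢ (2 *ℕ e)) n      ≡⟨ cong (λ m → (q ^ˢ (e +ℕ m)) n) (ℕ.+-identityʳ e) ⟩
  (q ^ˢ (e +ℕ e)) n      ∎
  where
  open ≡-Reasoning
  dilate-q : dilate q ≗ q ^ˢ 2
  dilate-q n = sym (trans (q^-coeff 2 n) (coeff n))
    where
    coeff : ∀ n → (if n ≡ᵇ 2 then + 1 else + 0) ≡ dilate q n
    coeff zero                      = refl
    coeff (suc zero)                = refl
    coeff (suc (suc zero))          = refl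
    coeff (suc (suc (suc zero)))    = refl
    coeff (suc (suc (suc (suc n)))) = sym (dilate-0ˢ n)

dilate-ι⊛ : ∀ σ a → dilate (ι σ ⊛ a) ≗ ι σ ⊛ dilate a
dilate-ι⊛ σ a n = begin
  dilate (ι σ ⊛ a) n       ≡⟨ dilate-cong (ι-⊛ σ a) n ⟩
  dilate (scale σ a) n     ≡⟨ dilate-scale σ a n ⟩
  scale σ (dilate a) n     ≡⟨ sym (ι-⊛ σ (dilate a) n) ⟩
  (ι σ ⊛ dilate a) n       ∎
  where open ≡-Reasoning

dilate-factor : ∀ σ e → dilate (factor σ e) ≗ factor σ (e +ℕ e)
dilate-factor σ e n = trans (dilate-+ one (ι σ ⊛ q ^ˢ e) n) (cong₂ _+_ (dilate-one n)
  (trans (dilate-ι⊛ σ (q ^ˢ e) n) (⊛-congʳ (ι σ) (dilate-q^ e) n)))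

double-exponent : ∀ b s N → (b +ℕ s *ℕ N) +ℕ (b +ℕ s *ℕ N) ≡ (b +ℕ b) +ℕ (s +ℕ s) *ℕ N
double-exponent = solve-∀

dilate-poch : ∀ σ b s N → dilate (poch σ b s N) ≗ poch σ (b +ℕ b) (s +ℕ s) N
dilate-poch σ b s zero    = dilate-one
dilate-poch σ b s (suc N) n = begin
  dilate (poch σ b s N ⊛ factor σ e) n
    ≡⟨ dilate-⊛ (poch σ b s N) (factor σ e) n ⟩
  (dilate (poch σ b s N) ⊛ dilate (factor σ e)) n
    ≡⟨ ⊛-congˡ (dilate (factor σ e)) (dilate-poch σ b s N) n ⟩
  (poch σ (b +ℕ b) (s +ℕ s) N ⊛ dilate (factor σ e)) n
    ≡⟨ ⊛-congʳ (poch σ (b +ℕ b) (s +ℕ s) N) (λ m → trans (dilate-factor σ e m) (cong (λ x → factor σ x m) (double-exponent b s N))) n ⟩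
  (poch σ (b +ℕ b) (s +ℕ s) N ⊛ factor σ ((b +ℕ b) +ℕ (s +ℕ s) *ℕ N)) n ∎
  where
  open ≡-Reasoning
  e = b +ℕ s *ℕ N

dilate-f : ∀ k → 1 ≤ k → dilate (f k) ≗ f (k +ℕ k)
dilate-f k 1≤k n = begin
  dilate (f k) n                         ≡⟨ dilate-≈ (f≈poch k n 1≤k) n n<2k[1+n] ⟩
  dilate (poch -1ℤ k k n) n              ≡⟨ dilate-poch -1ℤ k k n n ⟩
  poch -1ℤ (k +ℕ k) (k +ℕ k) n n         ≡⟨ sym (f≈poch (k +ℕ k) n 1≤2k n n<2k[1+n]′) ⟩
  f (k +ℕ k) n                           ∎
  where
  open ≡-Reasoning
  instance _ = >-nonZero 1≤k
  n<k[1+n] : n < k *ℕ suc n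
  n<k[1+n] = ℕ.m≤n*m (suc n) k
  n<2k[1+n] : n < k *ℕ suc n +ℕ k *ℕ suc n
  n<2k[1+n] = ℕ.≤-trans n<k[1+n] (ℕ.m≤m+n _ _)
  1≤2k = ℕ.≤-trans 1≤k (ℕ.m≤m+n k k)
  n<2k[1+n]′ : n < (k +ℕ k) *ℕ suc n
  n<2k[1+n]′ = subst (n <_) (sym (ℕ.*-distribʳ-+ (suc n) k k)) n<2k[1+n]

dilate-f^ : ∀ k e → 1 ≤ k → dilate (f k ^ˢ e) ≗ f (k +ℕ k) ^ˢ e
dilate-f^ k e 1≤k n = trans (dilate-^ˢ (f k) e n) (^ˢ-congˡ (dilate-f k 1≤k) e n)

dilate-⊛-inv : ∀ a b → b 0 ≡ 1ℤ → dilate (a ⊛ inv b) ⊛ dilate b ≗ dilate a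
dilate-⊛-inv a b b₀≡1 n = begin
  (dilate (a ⊛ inv b) ⊛ dilate b) n    ≡⟨ sym (dilate-⊛ (a ⊛ inv b) b n) ⟩
  dilate ((a ⊛ inv b) ⊛ b) n           ≡⟨ dilate-cong (λ m → ⊛-assoc a (inv b) b m) n ⟩
  dilate (a ⊛ (inv b ⊛ b)) n           ≡⟨ dilate-cong (⊛-congʳ a (⊛-inverseˡ b b₀≡1)) n ⟩
  dilate (a ⊛ one) n                   ≡⟨ dilate-cong (⊛-identityʳ a) n ⟩
  dilate a n                           ∎
  where open ≡-Reasoning

module GaussianBinomial (d : ℕ) where

  d₂ : ℕ
  d₂ = d +ℕ d

  infix 8 T^_

  T^_ : ℕ → Series
  T^ e = q ^ˢ (d₂ *ℕ e)

  TT : ℕ → Series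
  TT m = poch -1ℤ d₂ d₂ m

  atPred : (ℕ → Series) → ℕ → Series
  atPred g zero    = 0ˢ
  atPred g (suc j) = g j

  -- gauss N j is the Gaussian binomial [2N choose j] in T (see gauss-product);
  -- its recurrence is two steps of the q-Pascal rule, from 2N to 2N + 2.
  gauss : ℕ → ℕ → Series
  gauss zero    zero    = one
  gauss zero    (suc j) = 0ˢ
  gauss (suc N) zero    = gauss N zero
  gauss (suc N) (suc j) =
    ((one +ˢ T^ (suc (N +ℕ N))) ⊛ gauss N j +ˢ T^ (suc (N +ℕ N) ∸ j) ⊛ atPred (gauss N) j)
      +ˢ T^ (suc j) ⊛ gauss N (suc j)

  T^-+ : ∀ a b → T^ (a +ℕ b) ≗ T^ a ⊛ T^ b
  T^-+ a b n = trans (cong (λ e → (q ^ˢ e) n) (ℕ.*-distribˡ-+ d₂ a b)) (^ˢ-+ q (d₂ *ℕ a) (d₂ *ℕ b) n)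

  T^-suc : ∀ a → T^ (suc a) ≗ T^ a ⊛ T^ 1
  T^-suc a n = trans (cong (λ e → (T^ e) n) (ℕ.+-comm 1 a)) (T^-+ a 1 n)

  T^-zero : T^ 0 ≗ one
  T^-zero n = cong (λ e → (q ^ˢ e) n) (ℕ.*-zeroʳ d₂)

  TT-suc : ∀ m → TT (suc m) ≗ TT m ⊛ oneMinus (T^ (suc m))
  TT-suc m n = cong (λ e → (TT m ⊛ factor -1ℤ e) n) (sym (ℕ.*-suc d₂ m))

  gauss-vanishes : ∀ N j → N +ℕ N < j → gauss N j ≗ 0ˢ
  gauss-vanishes zero    (suc j)       _ _ = refl
  gauss-vanishes (suc N) (suc zero)    (s≤s ())
  gauss-vanishes (suc N) (suc (suc j)) (s≤s 2N+1<1+j) n = cong₂ _+_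
    (cong₂ _+_ (⊛-vanishʳ (one +ˢ T^ (suc (N +ℕ N))) (gauss-vanishes N (suc j) (ℕ.m<n⇒m<1+n 2N<j)) n)
               (⊛-vanishʳ (T^ (suc (N +ℕ N) ∸ suc j)) (gauss-vanishes N j 2N<j) n))
    (⊛-vanishʳ (T^ (suc (suc j))) (gauss-vanishes N (suc (suc j)) (ℕ.m<n⇒m<1+n (ℕ.m<n⇒m<1+n 2N<j))) n)
    where
    2N<j : N +ℕ N < j
    2N<j = subst (_≤ j) (ℕ.+-suc N N) (ℕ.≤-pred 2N+1<1+j)

  module _ (M : ℕ) where
    open Truncated M
    open ≈-Reasoning

    GaussProduct : ℕ → ℕ → Set
    GaussProduct N j = (gauss N j ⊛ TT j) ⊛ TT (N +ℕ N ∸ j) ≈ TT (N +ℕ N)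

    TT-suc-suc : ∀ N → TT (suc N +ℕ suc N) ≈ (TT (N +ℕ N) ⊛ oneMinus (T^ (suc (N +ℕ N)))) ⊛ oneMinus (T^ (suc (suc (N +ℕ N))))
    TT-suc-suc N = ≈-trans (≡⇒≈ TT (cong suc (ℕ.+-suc N N))) (≈-trans (≗⇒≈ (TT-suc (suc (N +ℕ N))))
      (substitute 2 (λ p x → p :* (1- x)) (≗⇒≈ (TT-suc (N +ℕ N)) ∷ ≈-refl {T^ (suc (suc (N +ℕ N)))} ∷ [])))

    1-T^0≈0 : oneMinus (T^ 0) ≈ 0ˢ
    1-T^0≈0 = begin
      oneMinus (T^ 0)  ≈⟨ substitute 1 (λ x → 1- x) (≗⇒≈ T^-zero ∷ []) ⟩
      oneMinus one     ≈⟨ solve 0 (1- :1 := :0) ≈-refl ⟩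
      ι (+ 0)          ≈⟨ ≗⇒≈ (λ n → sym (0ˢ≗ι0 n)) ⟩
      0ˢ               ∎

    gauss-product-pred : ∀ N → (∀ j → j ≤ N +ℕ N → GaussProduct N j) → ∀ j → j ≤ suc (N +ℕ N) →
      (atPred (gauss N) j ⊛ TT j) ⊛ TT (suc (N +ℕ N) ∸ j) ≈ TT (N +ℕ N) ⊛ oneMinus (T^ j)
    gauss-product-pred N ih zero _ = begin
      (0ˢ ⊛ one) ⊛ TT (suc (N +ℕ N))
        ≈⟨ substitute 2 (λ z p → (z :* :1) :* p) (≗⇒≈ 0ˢ≗ι0 ∷ ≈-refl {TT (suc (N +ℕ N))} ∷ []) ⟩
      (ι (+ 0) ⊛ one) ⊛ TT (suc (N +ℕ N))
        ≈⟨ solve 2 (λ p r → (:0 :* :1) :* p := r :* :0) ≈-refl (TT (suc (N +ℕ N))) (TT (N +ℕ N)) ⟩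
      TT (N +ℕ N) ⊛ ι (+ 0)
        ≈⟨ substitute 2 (λ r z → r :* z) (≈-refl {TT (N +ℕ N)} ∷ ≈-trans (≗⇒≈ (λ n → sym (0ˢ≗ι0 n))) (≈-sym 1-T^0≈0) ∷ []) ⟩
      TT (N +ℕ N) ⊛ oneMinus (T^ 0) ∎
    gauss-product-pred N ih (suc j) (s≤s j≤2N) = begin
      (gauss N j ⊛ TT (suc j)) ⊛ TT (N +ℕ N ∸ j)
        ≈⟨ substitute 3 (λ g p r → (g :* p) :* r) (≈-refl {gauss N j} ∷ ≗⇒≈ (TT-suc j) ∷ ≈-refl {TT (N +ℕ N ∸ j)} ∷ []) ⟩
      (gauss N j ⊛ (TT j ⊛ oneMinus (T^ (suc j)))) ⊛ TT (N +ℕ N ∸ j)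
        ≈⟨ solve 4 (λ g p x r → (g :* (p :* (1- x))) :* r := ((g :* p) :* r) :* (1- x)) ≈-refl
             (gauss N j) (TT j) (T^ (suc j)) (TT (N +ℕ N ∸ j)) ⟩
      ((gauss N j ⊛ TT j) ⊛ TT (N +ℕ N ∸ j)) ⊛ oneMinus (T^ (suc j))
        ≈⟨ substitute 2 (λ h x → h :* (1- x)) (ih j j≤2N ∷ ≈-refl {T^ (suc j)} ∷ []) ⟩
      TT (N +ℕ N) ⊛ oneMinus (T^ (suc j)) ∎

    gauss-product-suc : ∀ N → (∀ j → j ≤ N +ℕ N → GaussProduct N j) → ∀ j → j ≤ N +ℕ N →
      (gauss N (suc j) ⊛ TT (suc j)) ⊛ TT (N +ℕ N ∸ j) ≈ TT (N +ℕ N) ⊛ oneMinus (T^ (N +ℕ N ∸ j))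
    gauss-product-suc N ih j j≤2N with ℕ.m≤n⇒m<n∨m≡n j≤2N
    ... | inj₂ refl = begin
      (gauss N (suc 2N) ⊛ TT (suc 2N)) ⊛ TT (2N ∸ 2N)
        ≈⟨ substitute 3 (λ g p r → (g :* p) :* r)
             (≗⇒≈ (λ n → trans (gauss-vanishes N (suc 2N) ℕ.≤-refl n) (0ˢ≗ι0 n)) ∷ ≈-refl {TT (suc 2N)}
              ∷ ≡⇒≈ TT (ℕ.n∸n≡0 2N) ∷ []) ⟩
      (ι (+ 0) ⊛ TT (suc 2N)) ⊛ one
        ≈⟨ solve 2 (λ p r → (:0 :* p) :* :1 := r :* :0) ≈-refl (TT (suc 2N)) (TT 2N) ⟩
      TT 2N ⊛ ι (+ 0)
        ≈⟨ substitute 2 (λ r z → r :* z) (≈-refl {TT 2N}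
             ∷ ≈-trans (≗⇒≈ (λ n → sym (0ˢ≗ι0 n))) (≈-trans (≈-sym 1-T^0≈0) (≡⇒≈ (oneMinus ∘ T^_) (sym (ℕ.n∸n≡0 2N)))) ∷ []) ⟩
      TT 2N ⊛ oneMinus (T^ (2N ∸ 2N)) ∎
      where 2N = N +ℕ N
    ... | inj₁ j<2N = begin
      (gauss N (suc j) ⊛ TT (suc j)) ⊛ TT (2N ∸ j)
        ≈⟨ substitute 3 (λ g p r → (g :* p) :* r) (≈-refl {gauss N (suc j)} ∷ ≈-refl {TT (suc j)}
             ∷ ≈-trans (≡⇒≈ TT 2N∸j≡1+r) (≗⇒≈ (TT-suc r)) ∷ []) ⟩
      (gauss N (suc j) ⊛ TT (suc j)) ⊛ (TT r ⊛ oneMinus (T^ (suc r)))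
        ≈⟨ solve 4 (λ g p r x → (g :* p) :* (r :* (1- x)) := ((g :* p) :* r) :* (1- x)) ≈-refl
             (gauss N (suc j)) (TT (suc j)) (TT r) (T^ (suc r)) ⟩
      ((gauss N (suc j) ⊛ TT (suc j)) ⊛ TT r) ⊛ oneMinus (T^ (suc r))
        ≈⟨ substitute 2 (λ h x → h :* (1- x)) (ih (suc j) j<2N ∷ ≡⇒≈ T^_ (sym 2N∸j≡1+r) ∷ []) ⟩
      TT 2N ⊛ oneMinus (T^ (2N ∸ j)) ∎
      where
      2N = N +ℕ N
      r = 2N ∸ suc j
      2N∸j≡1+r : 2N ∸ j ≡ suc r
      2N∸j≡1+r = ℕ.+-∸-assoc 1 j<2N

    -- The inductive step rests on the identity, with A = T^j, B = T^(2N-j),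
    --   (1 + ABT)(1 - AT)(1 - BT) + BT(1 - AT)(1 - A) + AT(1 - BT)(1 - B) = (1 - ABT)(1 - ABT²).
    gauss-product-step : ∀ N → (∀ j → j ≤ N +ℕ N → GaussProduct N j) → ∀ j → j ≤ N +ℕ N → GaussProduct (suc N) (suc j)
    gauss-product-step N ih j j≤2N = begin
      ((((one +ˢ T^ (suc 2N)) ⊛ g₁ +ˢ T^ (suc 2N ∸ j) ⊛ g₀) +ˢ T^ (suc j) ⊛ g₂) ⊛ TT (suc j)) ⊛ TT (suc N +ℕ suc N ∸ suc j)
        ≈⟨ substitute 8 (λ g₁ g₀ g₂ x y z u v → ((((:1 :+ x) :* g₁ :+ y :* g₀) :+ z :* g₂) :* u) :* v)
             (≈-refl {g₁} ∷ ≈-refl {g₀} ∷ ≈-refl {g₂} ∷ T^[1+2N] ∷ T^[1+2N-j] ∷ ≗⇒≈ (T^-suc j)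
              ∷ TT[1+j] ∷ ≈-trans (≡⇒≈ TT (cong (_∸ j) (ℕ.+-suc N N))) TT[1+2N-j] ∷ []) ⟩
      ((((one +ˢ (A ⊛ B) ⊛ T) ⊛ g₁ +ˢ (B ⊛ T) ⊛ g₀) +ˢ (A ⊛ T) ⊛ g₂) ⊛ (Pj ⊛ oneMinus (A ⊛ T))) ⊛ (Pr ⊛ oneMinus (B ⊛ T))
        ≈⟨ solve 8 (λ g₁ g₀ g₂ a b t pj pr →
             ((((:1 :+ (a :* b) :* t) :* g₁ :+ (b :* t) :* g₀) :+ (a :* t) :* g₂) :* (pj :* (1- (a :* t)))) :* (pr :* (1- (b :* t)))
             := (((:1 :+ (a :* b) :* t) :* (1- (a :* t))) :* (1- (b :* t))) :* ((g₁ :* pj) :* pr)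
                :+ ((b :* t) :* (1- (a :* t))) :* ((g₀ :* pj) :* (pr :* (1- (b :* t))))
                :+ ((a :* t) :* (1- (b :* t))) :* ((g₂ :* (pj :* (1- (a :* t)))) :* pr))
             ≈-refl g₁ g₀ g₂ A B T Pj Pr ⟩
      (((one +ˢ (A ⊛ B) ⊛ T) ⊛ oneMinus (A ⊛ T)) ⊛ oneMinus (B ⊛ T)) ⊛ ((g₁ ⊛ Pj) ⊛ Pr)
        +ˢ ((B ⊛ T) ⊛ oneMinus (A ⊛ T)) ⊛ ((g₀ ⊛ Pj) ⊛ (Pr ⊛ oneMinus (B ⊛ T)))
        +ˢ ((A ⊛ T) ⊛ oneMinus (B ⊛ T)) ⊛ ((g₂ ⊛ (Pj ⊛ oneMinus (A ⊛ T))) ⊛ Pr)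
        ≈⟨ substitute 6 (λ a b t h₁ h₀ h₂ →
             (((:1 :+ (a :* b) :* t) :* (1- (a :* t))) :* (1- (b :* t))) :* h₁
             :+ ((b :* t) :* (1- (a :* t))) :* h₀
             :+ ((a :* t) :* (1- (b :* t))) :* h₂)
             (≈-refl {A} ∷ ≈-refl {B} ∷ ≈-refl {T} ∷ ih j j≤2N ∷ pred-case ∷ suc-case ∷ []) ⟩
      (((one +ˢ (A ⊛ B) ⊛ T) ⊛ oneMinus (A ⊛ T)) ⊛ oneMinus (B ⊛ T)) ⊛ P
        +ˢ ((B ⊛ T) ⊛ oneMinus (A ⊛ T)) ⊛ (P ⊛ oneMinus A)
        +ˢ ((A ⊛ T) ⊛ oneMinus (B ⊛ T)) ⊛ (P ⊛ oneMinus B)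
        ≈⟨ solve 4 (λ a b t p →
             (((:1 :+ (a :* b) :* t) :* (1- (a :* t))) :* (1- (b :* t))) :* p
             :+ ((b :* t) :* (1- (a :* t))) :* (p :* (1- a))
             :+ ((a :* t) :* (1- (b :* t))) :* (p :* (1- b))
             := (p :* (1- ((a :* b) :* t))) :* (1- (((a :* b) :* t) :* t)))
             ≈-refl A B T P ⟩
      (P ⊛ oneMinus ((A ⊛ B) ⊛ T)) ⊛ oneMinus (((A ⊛ B) ⊛ T) ⊛ T)
        ≈⟨ substitute 3 (λ p x y → (p :* (1- x)) :* (1- y)) (≈-refl {P} ∷ ≈-sym T^[1+2N] ∷ ≈-sym T^[2+2N] ∷ []) ⟩
      (P ⊛ oneMinus (T^ (suc 2N))) ⊛ oneMinus (T^ (suc (suc 2N)))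
        ≈⟨ ≈-sym (TT-suc-suc N) ⟩
      TT (suc N +ℕ suc N) ∎
      where
      2N = N +ℕ N
      r  = 2N ∸ j
      g₁ = gauss N j
      g₀ = atPred (gauss N) j
      g₂ = gauss N (suc j)
      A  = T^ j
      B  = T^ r
      T  = T^ 1
      Pj = TT j
      Pr = TT r
      P  = TT 2N
      1+2N∸j≡1+r : suc 2N ∸ j ≡ suc r
      1+2N∸j≡1+r = ℕ.+-∸-assoc 1 j≤2N
      T^[1+2N] : T^ (suc 2N) ≈ (A ⊛ B) ⊛ T
      T^[1+2N] = ≈-trans (≡⇒≈ T^_ (cong suc (sym (ℕ.m+[n∸m]≡n j≤2N))))
        (≈-trans (≗⇒≈ (T^-suc (j +ℕ r))) (substitute 2 (λ x t → x :* t) (≗⇒≈ (T^-+ j r) ∷ ≈-refl {T} ∷ [])))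
      T^[2+2N] : T^ (suc (suc 2N)) ≈ ((A ⊛ B) ⊛ T) ⊛ T
      T^[2+2N] = ≈-trans (≗⇒≈ (T^-suc (suc 2N))) (substitute 2 (λ x t → x :* t) (T^[1+2N] ∷ ≈-refl {T} ∷ []))
      T^[1+2N-j] : T^ (suc 2N ∸ j) ≈ B ⊛ T
      T^[1+2N-j] = ≈-trans (≡⇒≈ T^_ 1+2N∸j≡1+r) (≗⇒≈ (T^-suc r))
      TT[1+j] : TT (suc j) ≈ Pj ⊛ oneMinus (A ⊛ T)
      TT[1+j] = ≈-trans (≗⇒≈ (TT-suc j)) (substitute 2 (λ p x → p :* (1- x)) (≈-refl {Pj} ∷ ≗⇒≈ (T^-suc j) ∷ []))
      TT[1+2N-j] : TT (suc 2N ∸ j) ≈ Pr ⊛ oneMinus (B ⊛ T)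
      TT[1+2N-j] = ≈-trans (≡⇒≈ TT 1+2N∸j≡1+r)
        (≈-trans (≗⇒≈ (TT-suc r)) (substitute 2 (λ p x → p :* (1- x)) (≈-refl {Pr} ∷ ≗⇒≈ (T^-suc r) ∷ [])))
      pred-case : (g₀ ⊛ Pj) ⊛ (Pr ⊛ oneMinus (B ⊛ T)) ≈ P ⊛ oneMinus A
      pred-case = ≈-trans (substitute 3 (λ g p r → (g :* p) :* r) (≈-refl {g₀} ∷ ≈-refl {Pj} ∷ ≈-sym TT[1+2N-j] ∷ []))
        (gauss-product-pred N ih j (ℕ.m≤n⇒m≤1+n j≤2N))
      suc-case : (g₂ ⊛ (Pj ⊛ oneMinus (A ⊛ T))) ⊛ Pr ≈ P ⊛ oneMinus B
      suc-case = ≈-trans (substitute 3 (λ g p r → (g :* p) :* r) (≈-refl {g₂} ∷ ≈-sym TT[1+j] ∷ ≈-refl {Pr} ∷ []))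
        (gauss-product-suc N ih j j≤2N)

    gauss-product-top : ∀ N → (∀ j → j ≤ N +ℕ N → GaussProduct N j) → GaussProduct (suc N) (suc (suc (N +ℕ N)))
    gauss-product-top N ih = begin
      ((((one +ˢ X) ⊛ gauss N (suc 2N) +ˢ T^ (suc 2N ∸ suc 2N) ⊛ c) +ˢ Y ⊛ gauss N (suc (suc 2N)))
        ⊛ TT (suc (suc 2N))) ⊛ TT (suc N +ℕ suc N ∸ suc (suc 2N))
        ≈⟨ substitute 8 (λ x a b c y e k r → ((((:1 :+ x) :* a :+ b :* c) :+ y :* e) :* k) :* r)
             (≈-refl {X} ∷ vanish (suc 2N) ℕ.≤-refl ∷ ≈-trans (≡⇒≈ T^_ (ℕ.n∸n≡0 (suc 2N))) (≗⇒≈ T^-zero) ∷ ≈-refl {c} ∷ ≈-refl {Y}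
              ∷ vanish (suc (suc 2N)) (ℕ.m<n⇒m<1+n (ℕ.n<1+n 2N)) ∷ ≈-trans (≡⇒≈ TT (sym (cong suc (ℕ.+-suc N N)))) (TT-suc-suc N)
              ∷ ≡⇒≈ TT (trans (cong (_∸ suc 2N) (ℕ.+-suc N N)) (ℕ.n∸n≡0 (suc 2N))) ∷ []) ⟩
      ((((one +ˢ X) ⊛ ι (+ 0) +ˢ one ⊛ c) +ˢ Y ⊛ ι (+ 0)) ⊛ ((P ⊛ oneMinus X) ⊛ oneMinus Y)) ⊛ one
        ≈⟨ solve 4 (λ x c y p → ((((:1 :+ x) :* :0 :+ :1 :* c) :+ y :* :0) :* ((p :* (1- x)) :* (1- y))) :* :1
               := (((c :* p) :* :1) :* (1- x)) :* (1- y)) ≈-refl X c Y P ⟩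
      (((c ⊛ P) ⊛ one) ⊛ oneMinus X) ⊛ oneMinus Y
        ≈⟨ substitute 3 (λ h x y → (h :* (1- x)) :* (1- y))
             (≈-trans (⊛-cong {a = c ⊛ P} ≈-refl (≡⇒≈ TT (sym (ℕ.n∸n≡0 2N)))) (ih 2N ℕ.≤-refl) ∷ ≈-refl {X} ∷ ≈-refl {Y} ∷ []) ⟩
      (P ⊛ oneMinus X) ⊛ oneMinus Y
        ≈⟨ ≈-sym (TT-suc-suc N) ⟩
      TT (suc N +ℕ suc N) ∎
      where
      2N = N +ℕ N
      c  = gauss N 2N
      P  = TT 2N
      X  = T^ (suc 2N)
      Y  = T^ (suc (suc 2N))
      vanish : ∀ j → 2N < j → gauss N j ≈ ι (+ 0)
      vanish j 2N<j = ≗⇒≈ (λ n → trans (gauss-vanishes N j 2N<j n) (0ˢ≗ι0 n))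

    gauss-product : ∀ N j → j ≤ N +ℕ N → GaussProduct N j
    gauss-product zero    zero    _ = solve 0 ((:1 :* :1) :* :1 := :1) ≈-refl
    gauss-product (suc N) zero    _ = begin
      (gauss N 0 ⊛ one) ⊛ TT (suc N +ℕ suc N)
        ≈⟨ substitute 2 (λ g p → (g :* :1) :* p) (≈-refl {gauss N 0} ∷ TT-suc-suc N ∷ []) ⟩
      (gauss N 0 ⊛ one) ⊛ ((P ⊛ oneMinus X) ⊛ oneMinus Y)
        ≈⟨ solve 4 (λ g p x y → (g :* :1) :* ((p :* (1- x)) :* (1- y)) := (((g :* :1) :* p) :* (1- x)) :* (1- y))
             ≈-refl (gauss N 0) P X Y ⟩
      (((gauss N 0 ⊛ one) ⊛ P) ⊛ oneMinus X) ⊛ oneMinus Y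
        ≈⟨ substitute 3 (λ h x y → (h :* (1- x)) :* (1- y)) (gauss-product N 0 z≤n ∷ ≈-refl {X} ∷ ≈-refl {Y} ∷ []) ⟩
      (P ⊛ oneMinus X) ⊛ oneMinus Y
        ≈⟨ ≈-sym (TT-suc-suc N) ⟩
      TT (suc N +ℕ suc N) ∎
      where
      P = TT (N +ℕ N)
      X = T^ (suc (N +ℕ N))
      Y = T^ (suc (suc (N +ℕ N)))
    gauss-product (suc N) (suc j) 1+j≤2N+2 with ℕ.m≤n⇒m<n∨m≡n (subst (j ≤_) (ℕ.+-suc N N) (ℕ.≤-pred 1+j≤2N+2))
    ... | inj₁ j<2N+1 = gauss-product-step N (gauss-product N) j (ℕ.≤-pred j<2N+1)
    ... | inj₂ refl   = gauss-product-top N (gauss-product N)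

sqDist : ℕ → ℕ → ℕ
sqDist j n = ∣ j - n ∣ *ℕ ∣ j - n ∣

sqDist-+ʳ : ∀ i k → sqDist i (i +ℕ k) ≡ k *ℕ k
sqDist-+ʳ i k rewrite ℕ.∣m-m+n∣≡n i k = refl

sqDist-+ˡ : ∀ i k → sqDist (i +ℕ k) i ≡ k *ℕ k
sqDist-+ˡ i k rewrite ℕ.∣-∣-comm (i +ℕ k) i | ℕ.∣m-m+n∣≡n i k = refl

sqDist-zero-suc : ∀ N → sqDist 0 (suc N) ≡ suc (N +ℕ N) +ℕ sqDist 0 N
sqDist-zero-suc N = square-suc N
  where
  square-suc : ∀ N → suc N *ℕ suc N ≡ suc (N +ℕ N) +ℕ N *ℕ N
  square-suc = solve-∀

-- (j + 1 - N)² = (j - N)² + 2 (j - N) + 1, with both sides moved so that no subtraction occurs.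
sqDist-suc : ∀ j N → sqDist j N +ℕ (suc j +ℕ suc j) ≡ suc (N +ℕ N) +ℕ sqDist (suc j) N
sqDist-suc j N with N ℕ.≤? j
... | yes N≤j with ℕ.m≤n⇒∃[o]m+o≡n N≤j
...   | k , refl = begin
  sqDist (N +ℕ k) N +ℕ (suc (N +ℕ k) +ℕ suc (N +ℕ k))  ≡⟨ cong (_+ℕ (suc (N +ℕ k) +ℕ suc (N +ℕ k))) (sqDist-+ˡ N k) ⟩
  k *ℕ k +ℕ (suc (N +ℕ k) +ℕ suc (N +ℕ k))             ≡⟨ identity N k ⟩
  suc (N +ℕ N) +ℕ suc k *ℕ suc k                       ≡⟨ cong (suc (N +ℕ N) +ℕ_) (sym (sqDist-+ˡ N (suc k))) ⟩
  suc (N +ℕ N) +ℕ sqDist (N +ℕ suc k) N                ≡⟨ cong (λ x → suc (N +ℕ N) +ℕ sqDist x N) (ℕ.+-suc N k) ⟩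
  suc (N +ℕ N) +ℕ sqDist (suc (N +ℕ k)) N              ∎
  where
  open ≡-Reasoning
  identity : ∀ N k → k *ℕ k +ℕ (suc (N +ℕ k) +ℕ suc (N +ℕ k)) ≡ suc (N +ℕ N) +ℕ suc k *ℕ suc k
  identity = solve-∀
sqDist-suc j N | no N≰j with ℕ.m≤n⇒∃[o]m+o≡n (ℕ.≰⇒> N≰j)
... | k , refl = begin
  sqDist j (suc (j +ℕ k)) +ℕ (suc j +ℕ suc j)          ≡⟨ cong (λ x → sqDist j x +ℕ (suc j +ℕ suc j)) (sym (ℕ.+-suc j k)) ⟩
  sqDist j (j +ℕ suc k) +ℕ (suc j +ℕ suc j)            ≡⟨ cong (_+ℕ (suc j +ℕ suc j)) (sqDist-+ʳ j (suc k)) ⟩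
  suc k *ℕ suc k +ℕ (suc j +ℕ suc j)                   ≡⟨ identity j k ⟩
  suc (suc (j +ℕ k) +ℕ suc (j +ℕ k)) +ℕ k *ℕ k         ≡⟨ cong (suc (suc (j +ℕ k) +ℕ suc (j +ℕ k)) +ℕ_) (sym (sqDist-+ʳ j k)) ⟩
  suc (suc (j +ℕ k) +ℕ suc (j +ℕ k)) +ℕ sqDist j (j +ℕ k) ∎
  where
  open ≡-Reasoning
  identity : ∀ j k → suc k *ℕ suc k +ℕ (suc j +ℕ suc j) ≡ suc (suc (j +ℕ k) +ℕ suc (j +ℕ k)) +ℕ k *ℕ k
  identity = solve-∀

sqDist-suc-mirror : ∀ N i → i ≤ N +ℕ N → sqDist (suc i) N +ℕ ((N +ℕ N ∸ i) +ℕ (N +ℕ N ∸ i)) ≡ suc (N +ℕ N) +ℕ sqDist i N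
sqDist-suc-mirror N i i≤2N = ℕ.+-cancelʳ-≡ (suc i +ℕ suc i) _ _ (begin
  sqDist (suc i) N +ℕ (t +ℕ t) +ℕ (suc i +ℕ suc i)   ≡⟨ regroup (sqDist (suc i) N) t i ⟩
  sqDist (suc i) N +ℕ suc (t +ℕ i) +ℕ suc (t +ℕ i)   ≡⟨ cong (λ m → sqDist (suc i) N +ℕ suc m +ℕ suc m) t+i≡2N ⟩
  sqDist (suc i) N +ℕ suc (N +ℕ N) +ℕ suc (N +ℕ N)   ≡⟨ reorder (sqDist (suc i) N) (N +ℕ N) ⟩
  suc (N +ℕ N) +ℕ (suc (N +ℕ N) +ℕ sqDist (suc i) N) ≡⟨ cong (suc (N +ℕ N) +ℕ_) (sym (sqDist-suc i N)) ⟩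
  suc (N +ℕ N) +ℕ (sqDist i N +ℕ (suc i +ℕ suc i))   ≡⟨ sym (ℕ.+-assoc (suc (N +ℕ N)) (sqDist i N) _) ⟩
  suc (N +ℕ N) +ℕ sqDist i N +ℕ (suc i +ℕ suc i)     ∎)
  where
  open ≡-Reasoning
  t = N +ℕ N ∸ i
  t+i≡2N = ℕ.m∸n+n≡m i≤2N
  regroup : ∀ s t i → s +ℕ (t +ℕ t) +ℕ (suc i +ℕ suc i) ≡ s +ℕ suc (t +ℕ i) +ℕ suc (t +ℕ i)
  regroup = solve-∀
  reorder : ∀ s n → s +ℕ suc n +ℕ suc n ≡ suc n +ℕ (suc n +ℕ s)
  reorder = solve-∀

k≤k*k : ∀ k → k ≤ k *ℕ k
k≤k*k zero    = z≤n
k≤k*k (suc k) = ℕ.m≤m*n (suc k) (suc k)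

k+k≤k*k+1 : ∀ k → k +ℕ k ≤ k *ℕ k +ℕ 1
k+k≤k*k+1 zero    = z≤n
k+k≤k*k+1 (suc k) = ℕ.≤-trans (ℕ.m≤m+n (suc k +ℕ suc k) (k *ℕ k)) (ℕ.≤-reflexive (expand k))
  where
  expand : ∀ k → suc k +ℕ suc k +ℕ k *ℕ k ≡ suc k *ℕ suc k +ℕ 1
  expand = solve-∀

-- An index j ∈ [0, 2N] at distance k from N; the smaller of j and 2N - j is m = N - k.
data Position : ℕ → ℕ → Set where
  left  : ∀ m k → Position (m +ℕ k) m
  right : ∀ m k → Position (m +ℕ k) (m +ℕ k +ℕ k)

position : ∀ N j → j ≤ N +ℕ N → Position N j
position N j j≤2N with ℕ.≤-total j N
... | inj₁ j≤N with ℕ.m≤n⇒∃[o]m+o≡n j≤N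
...   | k , refl = left j k
position N j j≤2N | inj₂ N≤j with ℕ.m≤n⇒∃[o]m+o≡n N≤j
... | k , refl with ℕ.m≤n⇒∃[o]m+o≡n (ℕ.+-cancelˡ-≤ N k N j≤2N)
...   | m , refl = subst (λ n → Position n (n +ℕ k)) (ℕ.+-comm m k) (right m k)

m≤m+k+k : ∀ m k → m ≤ m +ℕ k +ℕ k
m≤m+k+k m k = ℕ.≤-trans (ℕ.m≤m+n m k) (ℕ.m≤m+n (m +ℕ k) k)

left-sum : ∀ m k → m +ℕ (m +ℕ k +ℕ k) ≡ (m +ℕ k) +ℕ (m +ℕ k)
left-sum = solve-∀

right-sum : ∀ m k → (m +ℕ k +ℕ k) +ℕ m ≡ (m +ℕ k) +ℕ (m +ℕ k)
right-sum = solve-∀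

limit-precision₀ : ∀ m k → suc (m +ℕ k) ≤ k *ℕ k +ℕ (suc m +ℕ suc m)
limit-precision₀ m k = begin
  suc (m +ℕ k)                   ≤⟨ s≤s (ℕ.+-monoʳ-≤ m (ℕ.m≤m+n k k)) ⟩
  suc (m +ℕ (k +ℕ k))             ≤⟨ s≤s (ℕ.+-monoʳ-≤ m (k+k≤k*k+1 k)) ⟩
  suc (m +ℕ (k *ℕ k +ℕ 1))         ≤⟨ s≤s (ℕ.m≤n+m _ m) ⟩
  suc (m +ℕ (m +ℕ (k *ℕ k +ℕ 1)))   ≡⟨ regroup m k ⟩
  k *ℕ k +ℕ (suc m +ℕ suc m)       ∎
  where
  open ℕ.≤-Reasoning
  regroup : ∀ m k → suc (m +ℕ (m +ℕ (k *ℕ k +ℕ 1))) ≡ k *ℕ k +ℕ (suc m +ℕ suc m)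
  regroup = solve-∀

limit-precision₁ : ∀ m k → suc ((m +ℕ k) +ℕ (m +ℕ k)) ≤ m +ℕ (k *ℕ k +ℕ (suc m +ℕ suc m))
limit-precision₁ m k = begin
  suc ((m +ℕ k) +ℕ (m +ℕ k))             ≡⟨ regroup₁ m k ⟩
  suc (m +ℕ m +ℕ (k +ℕ k))               ≤⟨ s≤s (ℕ.+-monoʳ-≤ (m +ℕ m) (k+k≤k*k+1 k)) ⟩
  suc (m +ℕ m +ℕ (k *ℕ k +ℕ 1))           ≤⟨ ℕ.m≤n+m _ m ⟩
  m +ℕ suc (m +ℕ m +ℕ (k *ℕ k +ℕ 1))       ≡⟨ regroup₂ m k ⟩
  m +ℕ (k *ℕ k +ℕ (suc m +ℕ suc m))       ∎
  where
  open ℕ.≤-Reasoning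
  regroup₁ : ∀ m k → suc ((m +ℕ k) +ℕ (m +ℕ k)) ≡ suc (m +ℕ m +ℕ (k +ℕ k))
  regroup₁ = solve-∀
  regroup₂ : ∀ m k → m +ℕ suc (m +ℕ m +ℕ (k *ℕ k +ℕ 1)) ≡ m +ℕ (k *ℕ k +ℕ (suc m +ℕ suc m))
  regroup₂ = solve-∀

N≤j+sqDist : ∀ N j → N ≤ j +ℕ sqDist j N
N≤j+sqDist N j with ℕ.≤-total j N
... | inj₁ j≤N with ℕ.m≤n⇒∃[o]m+o≡n j≤N
...   | k , refl rewrite sqDist-+ʳ j k = ℕ.+-monoʳ-≤ j (k≤k*k k)
N≤j+sqDist N j | inj₂ N≤j = ℕ.≤-trans N≤j (ℕ.m≤m+n j _)

∣i+i-N+N∣ : ∀ i N → ∣ (i +ℕ i) - (N +ℕ N) ∣ ≡ ∣ i - N ∣ +ℕ ∣ i - N ∣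
∣i+i-N+N∣ zero    N       = refl
∣i+i-N+N∣ (suc i) zero    = refl
∣i+i-N+N∣ (suc i) (suc N) rewrite ℕ.+-suc i i | ℕ.+-suc N N = ∣i+i-N+N∣ i N

sqDist-even : ∀ i N → sqDist (i +ℕ i) (N +ℕ N) ≡ 4 *ℕ sqDist i N
sqDist-even i N rewrite ∣i+i-N+N∣ i N = double-square ∣ i - N ∣
  where
  double-square : ∀ x → (x +ℕ x) *ℕ (x +ℕ x) ≡ 4 *ℕ (x *ℕ x)
  double-square = solve-∀

sqDist-odd : ∀ i N → sqDist (suc (i +ℕ i)) (N +ℕ N) ≡ suc (4 *ℕ ((i +ℕ sqDist i N) ∸ N))
sqDist-odd i N = ℕ.+-cancelˡ-≡ (suc ((N +ℕ N) +ℕ (N +ℕ N))) _ _ (begin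
  suc ((N +ℕ N) +ℕ (N +ℕ N)) +ℕ sqDist (suc (i +ℕ i)) (N +ℕ N) ≡⟨ sym (sqDist-suc (i +ℕ i) (N +ℕ N)) ⟩
  sqDist (i +ℕ i) (N +ℕ N) +ℕ (suc (i +ℕ i) +ℕ suc (i +ℕ i))  ≡⟨ cong (_+ℕ (suc (i +ℕ i) +ℕ suc (i +ℕ i))) (sqDist-even i N) ⟩
  4 *ℕ sqDist i N +ℕ (suc (i +ℕ i) +ℕ suc (i +ℕ i))          ≡⟨ lhs-form (sqDist i N) i ⟩
  2 +ℕ 4 *ℕ (i +ℕ sqDist i N)                              ≡⟨ cong (λ x → 2 +ℕ 4 *ℕ x) (sym N+e≡i+sqDist) ⟩
  2 +ℕ 4 *ℕ (N +ℕ e)                                       ≡⟨ rhs-form N e ⟩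
  suc ((N +ℕ N) +ℕ (N +ℕ N)) +ℕ suc (4 *ℕ e)                 ∎)
  where
  open ≡-Reasoning
  e = (i +ℕ sqDist i N) ∸ N
  N+e≡i+sqDist : N +ℕ e ≡ i +ℕ sqDist i N
  N+e≡i+sqDist = ℕ.m+[n∸m]≡n (N≤j+sqDist N i)
  lhs-form : ∀ s i → 4 *ℕ s +ℕ (suc (i +ℕ i) +ℕ suc (i +ℕ i)) ≡ 2 +ℕ 4 *ℕ (i +ℕ s)
  lhs-form = solve-∀
  rhs-form : ∀ N e → 2 +ℕ 4 *ℕ (N +ℕ e) ≡ suc ((N +ℕ N) +ℕ (N +ℕ N)) +ℕ suc (4 *ℕ e)
  rhs-form = solve-∀

sumˢ : (ℕ → Series) → ℕ → Series
sumˢ g zero    = g 0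
sumˢ g (suc D) = sumˢ g D +ˢ g (suc D)

sumˢ-cong : ∀ {M g h} D → (∀ j → j ≤ D → g j ≈[ M ] h j) → sumˢ g D ≈[ M ] sumˢ h D
sumˢ-cong zero    g≈h = g≈h 0 z≤n
sumˢ-cong (suc D) g≈h n n<M = cong₂ _+_
  (sumˢ-cong D (λ j j≤D → g≈h j (ℕ.m≤n⇒m≤1+n j≤D)) n n<M) (g≈h (suc D) ℕ.≤-refl n n<M)

sumˢ-suc : ∀ g D → sumˢ g (suc D) ≗ g 0 +ˢ sumˢ (λ j → g (suc j)) D
sumˢ-suc g zero    n = refl
sumˢ-suc g (suc D) n =
  trans (cong (_+ g (suc (suc D)) n) (sumˢ-suc g D n)) (ℤ.+-assoc (g 0 n) _ _)

sumˢ-+ : ∀ g h D → sumˢ (λ j → g j +ˢ h j) D ≗ sumˢ g D +ˢ sumˢ h D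
sumˢ-+ g h zero    n = refl
sumˢ-+ g h (suc D) n = trans (cong (_+ (g (suc D) n + h (suc D) n)) (sumˢ-+ g h D n))
  (+-interchange (sumˢ g D n) (sumˢ h D n) (g (suc D) n) (h (suc D) n))

⊛-sumˢ : ∀ a g D → a ⊛ sumˢ g D ≗ sumˢ (λ j → a ⊛ g j) D
⊛-sumˢ a g zero    n = refl
⊛-sumˢ a g (suc D) n =
  trans (⊛-distribˡ-+ a (sumˢ g D) (g (suc D)) n) (cong (_+ (a ⊛ g (suc D)) n) (⊛-sumˢ a g D n))

sumˢ-vanishing-tail : ∀ g D k → (∀ j → D < j → g j ≗ 0ˢ) → sumˢ g (k +ℕ D) ≗ sumˢ g D
sumˢ-vanishing-tail g D zero    g≗0 n = refl
sumˢ-vanishing-tail g D (suc k) g≗0 n = trans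
  (cong₂ _+_ (sumˢ-vanishing-tail g D k g≗0 n) (g≗0 (suc (k +ℕ D)) (s≤s (ℕ.m≤n+m D k)) n))
  (ℤ.+-identityʳ _)

module JacobiTripleProduct (d : ℕ) where
  open GaussianBinomial d public

  infix 8 Q^_

  Q^_ : ℕ → Series
  Q^ e = q ^ˢ (d *ℕ e)

  Q^-+ : ∀ a b → Q^ (a +ℕ b) ≗ Q^ a ⊛ Q^ b
  Q^-+ a b n = trans (cong (λ e → (q ^ˢ e) n) (ℕ.*-distribˡ-+ d a b)) (^ˢ-+ q (d *ℕ a) (d *ℕ b) n)

  Q^-zero : Q^ 0 ≗ one
  Q^-zero n = cong (λ e → (q ^ˢ e) n) (ℕ.*-zeroʳ d)

  T^≗Q^ : ∀ b → T^ b ≗ Q^ (b +ℕ b)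
  T^≗Q^ b n = cong (λ e → (q ^ˢ e) n) (trans (ℕ.*-distribʳ-+ b d d) (sym (ℕ.*-distribˡ-+ d b b)))

  Q^-T^-exchange : ∀ a b {c e} g → a +ℕ (b +ℕ b) ≡ c +ℕ e → Q^ a ⊛ (T^ b ⊛ g) ≗ Q^ c ⊛ (Q^ e ⊛ g)
  Q^-T^-exchange a b {c} {e} g eq n = begin
    (Q^ a ⊛ (T^ b ⊛ g)) n            ≡⟨ sym (⊛-assoc (Q^ a) (T^ b) g n) ⟩
    ((Q^ a ⊛ T^ b) ⊛ g) n            ≡⟨ ⊛-congˡ g (λ m → ⊛-congʳ (Q^ a) (T^≗Q^ b) m) n ⟩
    ((Q^ a ⊛ Q^ (b +ℕ b)) ⊛ g) n     ≡⟨ ⊛-congˡ g (λ m → sym (Q^-+ a (b +ℕ b) m)) n ⟩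
    (Q^ (a +ℕ (b +ℕ b)) ⊛ g) n       ≡⟨ cong (λ x → (Q^ x ⊛ g) n) eq ⟩
    (Q^ (c +ℕ e) ⊛ g) n              ≡⟨ ⊛-congˡ g (Q^-+ c e) n ⟩
    ((Q^ c ⊛ Q^ e) ⊛ g) n            ≡⟨ ⊛-assoc (Q^ c) (Q^ e) g n ⟩
    (Q^ c ⊛ (Q^ e ⊛ g)) n            ∎
    where open ≡-Reasoning

  jacobiTerm : ℕ → ℕ → Series
  jacobiTerm N j = Q^ (sqDist j N) ⊛ gauss N j

  jacobiTerm-vanishes : ∀ N j → N +ℕ N < j → jacobiTerm N j ≗ 0ˢ
  jacobiTerm-vanishes N j 2N<j = ⊛-vanishʳ (Q^ (sqDist j N)) (gauss-vanishes N j 2N<j)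

  jacobiTerm-suc-zero : ∀ N → jacobiTerm (suc N) 0 ≗ Q^ (suc (N +ℕ N)) ⊛ jacobiTerm N 0
  jacobiTerm-suc-zero N n = begin
    (Q^ (sqDist 0 (suc N)) ⊛ gauss N 0) n
      ≡⟨ ⊛-congˡ (gauss N 0) (λ m → trans (cong (λ e → (Q^ e) m) (sqDist-zero-suc N)) (Q^-+ _ _ m)) n ⟩
    ((Q^ (suc (N +ℕ N)) ⊛ Q^ (sqDist 0 N)) ⊛ gauss N 0) n
      ≡⟨ ⊛-assoc (Q^ (suc (N +ℕ N))) (Q^ (sqDist 0 N)) (gauss N 0) n ⟩
    (Q^ (suc (N +ℕ N)) ⊛ jacobiTerm N 0) n ∎
    where open ≡-Reasoning

  jacobiSummand : Series → ℕ → ℕ → Series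
  jacobiSummand c N j = c ^ˢ j ⊛ jacobiTerm N j

  jacobiSum : Series → ℕ → Series
  jacobiSum c N = sumˢ (jacobiSummand c N) (N +ℕ N)

  jacobiProduct : Series → ℕ → Series
  jacobiProduct c zero    = one
  jacobiProduct c (suc N) = jacobiProduct c N ⊛ ((Q^ (suc (N +ℕ N)) +ˢ c) ⊛ (one +ˢ Q^ (suc (N +ℕ N)) ⊛ c))

  jacobiSum-extend : ∀ c N k → sumˢ (jacobiSummand c N) (k +ℕ (N +ℕ N)) ≗ jacobiSum c N
  jacobiSum-extend c N k = sumˢ-vanishing-tail (jacobiSummand c N) (N +ℕ N) k
    (λ j 2N<j → ⊛-vanishʳ (c ^ˢ j) (jacobiTerm-vanishes N j 2N<j))

  module _ (M : ℕ) where
    open Truncated M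
    open ≈-Reasoning

    jacobiTerm-suc : ∀ N j → j ≤ suc (N +ℕ N) →
      jacobiTerm (suc N) (suc j)
        ≈ ((one +ˢ T^ (suc (N +ℕ N))) ⊛ jacobiTerm N j +ˢ Q^ (suc (N +ℕ N)) ⊛ atPred (jacobiTerm N) j)
          +ˢ Q^ (suc (N +ℕ N)) ⊛ jacobiTerm N (suc j)
    jacobiTerm-suc N j j≤2N+1 = begin
      Q^ s ⊛ (((one +ˢ T^ (suc 2N)) ⊛ gauss N j +ˢ T^ (suc 2N ∸ j) ⊛ atPred (gauss N) j) +ˢ T^ (suc j) ⊛ gauss N (suc j))
        ≈⟨ solve 7 (λ x t g a g₀ b g₂ → x :* (((:1 :+ t) :* g :+ a :* g₀) :+ b :* g₂)
                      := ((:1 :+ t) :* (x :* g) :+ x :* (a :* g₀)) :+ x :* (b :* g₂))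
             ≈-refl (Q^ s) (T^ (suc 2N)) (gauss N j) (T^ (suc 2N ∸ j)) (atPred (gauss N) j) (T^ (suc j)) (gauss N (suc j)) ⟩
      ((one +ˢ T^ (suc 2N)) ⊛ jacobiTerm N j +ˢ Q^ s ⊛ (T^ (suc 2N ∸ j) ⊛ atPred (gauss N) j))
        +ˢ Q^ s ⊛ (T^ (suc j) ⊛ gauss N (suc j))
        ≈⟨ +-cong (+-cong (≈-refl {(one +ˢ T^ (suc 2N)) ⊛ jacobiTerm N j}) (pred-term j j≤2N+1))
             (≗⇒≈ (Q^-T^-exchange s (suc j) {suc 2N} (gauss N (suc j)) (sqDist-suc j N))) ⟩
      ((one +ˢ T^ (suc 2N)) ⊛ jacobiTerm N j +ˢ Q^ (suc 2N) ⊛ atPred (jacobiTerm N) j)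
        +ˢ Q^ (suc 2N) ⊛ jacobiTerm N (suc j) ∎
      where
      2N = N +ℕ N
      s  = sqDist j N
      pred-term : ∀ j → j ≤ suc 2N →
        Q^ (sqDist j N) ⊛ (T^ (suc 2N ∸ j) ⊛ atPred (gauss N) j) ≈ Q^ (suc 2N) ⊛ atPred (jacobiTerm N) j
      pred-term zero    _         = ≗⇒≈ (λ n → trans
        (⊛-vanishʳ (Q^ (sqDist 0 N)) (⊛-vanishʳ (T^ (suc 2N)) (λ _ → refl)) n)
        (sym (⊛-vanishʳ (Q^ (suc 2N)) (λ _ → refl) n)))
      pred-term (suc i) (s≤s i≤2N) =
        ≗⇒≈ (Q^-T^-exchange (sqDist (suc i) N) (2N ∸ i) {suc 2N} (gauss N i) (sqDist-suc-mirror N i i≤2N))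

    jacobiSum-suc : ∀ c N →
      jacobiSum c (suc N) ≈ ((Q^ (suc (N +ℕ N)) +ˢ c) ⊛ (one +ˢ Q^ (suc (N +ℕ N)) ⊛ c)) ⊛ jacobiSum c N
    jacobiSum-suc c N = begin
      jacobiSum c (suc N)
        ≈⟨ ≡⇒≈ (sumˢ (jacobiSummand c (suc N))) (cong suc (ℕ.+-suc N N)) ⟩
      sumˢ (jacobiSummand c (suc N)) (suc D)
        ≈⟨ ≗⇒≈ (sumˢ-suc (jacobiSummand c (suc N)) D) ⟩
      one ⊛ jacobiTerm (suc N) 0 +ˢ sumˢ (λ j → (c ⊛ c ^ˢ j) ⊛ jacobiTerm (suc N) (suc j)) D
        ≈⟨ +-cong (⊛-cong (≈-refl {one}) (≗⇒≈ (jacobiTerm-suc-zero N))) (sumˢ-cong D step) ⟩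
      one ⊛ (y ⊛ jacobiTerm N 0)
        +ˢ sumˢ (λ j → (u ⊛ (c ^ˢ j ⊛ jacobiTerm N j) +ˢ (y ⊛ c) ⊛ (c ^ˢ j ⊛ atPred (jacobiTerm N) j))
                         +ˢ y ⊛ ((c ⊛ c ^ˢ j) ⊛ jacobiTerm N (suc j))) D
        ≈⟨ +-cong (≈-refl {one ⊛ (y ⊛ jacobiTerm N 0)}) (≗⇒≈ distribute) ⟩
      one ⊛ (y ⊛ jacobiTerm N 0) +ˢ ((u ⊛ S₁ +ˢ (y ⊛ c) ⊛ S₀) +ˢ y ⊛ S₂)
        ≈⟨ solve 8 (λ o w x u e₁ e₀ e₂ c → o :* (x :* w) :+ ((u :* e₁ :+ (x :* c) :* e₀) :+ x :* e₂)
                      := (u :* e₁ :+ (x :* c) :* e₀) :+ x :* (o :* w :+ e₂))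
             ≈-refl one (jacobiTerm N 0) y u S₁ S₀ S₂ c ⟩
      (u ⊛ S₁ +ˢ (y ⊛ c) ⊛ S₀) +ˢ y ⊛ (one ⊛ jacobiTerm N 0 +ˢ S₂)
        ≈⟨ substitute 6 (λ t s₁ s₀ s₂ x c → (((:1 :+ t) :* c) :* s₁ :+ (x :* c) :* s₀) :+ x :* s₂)
             (≗⇒≈ (T^≗Q^ D) ∷ ≗⇒≈ (jacobiSum-extend c N 1) ∷ shifted ∷ unshifted ∷ ≈-refl {y} ∷ ≈-refl {c} ∷ []) ⟩
      (((one +ˢ Q^ (D +ℕ D)) ⊛ c) ⊛ E +ˢ (y ⊛ c) ⊛ (c ⊛ E)) +ˢ y ⊛ E
        ≈⟨ substitute 4 (λ t c x e → (((:1 :+ t) :* c) :* e :+ (x :* c) :* (c :* e)) :+ x :* e)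
             (≗⇒≈ (Q^-+ D D) ∷ ≈-refl {c} ∷ ≈-refl {y} ∷ ≈-refl {E} ∷ []) ⟩
      (((one +ˢ y ⊛ y) ⊛ c) ⊛ E +ˢ (y ⊛ c) ⊛ (c ⊛ E)) +ˢ y ⊛ E
        ≈⟨ solve 3 (λ x c e → (((:1 :+ x :* x) :* c) :* e :+ (x :* c) :* (c :* e)) :+ x :* e
                      := ((x :+ c) :* (:1 :+ x :* c)) :* e)
             ≈-refl y c E ⟩
      ((y +ˢ c) ⊛ (one +ˢ y ⊛ c)) ⊛ E ∎
      where
      D  = suc (N +ℕ N)
      y  = Q^ D
      u  = (one +ˢ T^ D) ⊛ c
      E  = jacobiSum c N
      S₁ = sumˢ (jacobiSummand c N) D
      S₀ = sumˢ (λ j → c ^ˢ j ⊛ atPred (jacobiTerm N) j) D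
      S₂ = sumˢ (λ j → (c ⊛ c ^ˢ j) ⊛ jacobiTerm N (suc j)) D
      step : ∀ j → j ≤ D →
        (c ⊛ c ^ˢ j) ⊛ jacobiTerm (suc N) (suc j)
          ≈ (u ⊛ (c ^ˢ j ⊛ jacobiTerm N j) +ˢ (y ⊛ c) ⊛ (c ^ˢ j ⊛ atPred (jacobiTerm N) j))
            +ˢ y ⊛ ((c ⊛ c ^ˢ j) ⊛ jacobiTerm N (suc j))
      step j j≤D = ≈-trans (⊛-cong (≈-refl {c ⊛ c ^ˢ j}) (jacobiTerm-suc N j j≤D))
        (solve 7 (λ c cʲ t w x w₀ w₂ → (c :* cʲ) :* (((:1 :+ t) :* w :+ x :* w₀) :+ x :* w₂)
                    := (((:1 :+ t) :* c) :* (cʲ :* w) :+ (x :* c) :* (cʲ :* w₀)) :+ x :* ((c :* cʲ) :* w₂))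
           ≈-refl c (c ^ˢ j) (T^ D) (jacobiTerm N j) y (atPred (jacobiTerm N) j) (jacobiTerm N (suc j)))
      distribute : sumˢ (λ j → (u ⊛ (c ^ˢ j ⊛ jacobiTerm N j) +ˢ (y ⊛ c) ⊛ (c ^ˢ j ⊛ atPred (jacobiTerm N) j))
                                 +ˢ y ⊛ ((c ⊛ c ^ˢ j) ⊛ jacobiTerm N (suc j))) D
                   ≗ (u ⊛ S₁ +ˢ (y ⊛ c) ⊛ S₀) +ˢ y ⊛ S₂
      distribute n = trans (sumˢ-+ _ _ D n) (trans (cong (_+ (sumˢ (λ j → y ⊛ ((c ⊛ c ^ˢ j) ⊛ jacobiTerm N (suc j))) D n)) (sumˢ-+ _ _ D n))
        (sym (cong₂ _+_ (cong₂ _+_ (⊛-sumˢ u _ D n) (⊛-sumˢ (y ⊛ c) _ D n)) (⊛-sumˢ y _ D n))))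
      shifted : S₀ ≈ c ⊛ E
      shifted = ≈-trans (≗⇒≈ (sumˢ-suc _ (N +ℕ N)))
        (≈-trans (+-cong (≗⇒≈ (⊛-vanishʳ one (λ _ → refl))) (sumˢ-cong (N +ℕ N) (λ j _ → ≗⇒≈ (⊛-assoc c (c ^ˢ j) (jacobiTerm N j)))))
          (≈-trans (≗⇒≈ (λ n → ℤ.+-identityˡ _)) (≗⇒≈ (λ n → sym (⊛-sumˢ c (jacobiSummand c N) (N +ℕ N) n)))))
      unshifted : one ⊛ jacobiTerm N 0 +ˢ S₂ ≈ E
      unshifted = ≈-trans (≗⇒≈ (λ n → sym (sumˢ-suc (jacobiSummand c N) D n))) (≗⇒≈ (jacobiSum-extend c N 2))

    jacobi-finite : ∀ c N → jacobiSum c N ≈ jacobiProduct c N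
    jacobi-finite c zero = begin
      one ⊛ (Q^ 0 ⊛ one)    ≈⟨ substitute 1 (λ x → :1 :* (x :* :1)) (≗⇒≈ Q^-zero ∷ []) ⟩
      one ⊛ (one ⊛ one)     ≈⟨ solve 0 (:1 :* (:1 :* :1) := :1) ≈-refl ⟩
      one                   ∎
    jacobi-finite c (suc N) = begin
      jacobiSum c (suc N)       ≈⟨ jacobiSum-suc c N ⟩
      F ⊛ jacobiSum c N         ≈⟨ ⊛-cong (≈-refl {F}) (jacobi-finite c N) ⟩
      F ⊛ jacobiProduct c N     ≈⟨ ≗⇒≈ (⊛-comm F (jacobiProduct c N)) ⟩
      jacobiProduct c (suc N)   ∎
      where F = (Q^ (suc (N +ℕ N)) +ˢ c) ⊛ (one +ˢ Q^ (suc (N +ℕ N)) ⊛ c)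

    Q^-suc : ∀ a → Q^ (suc a) ≈ Q^ a ⊛ Q^ 1
    Q^-suc a = ≈-trans (≡⇒≈ Q^_ (ℕ.+-comm 1 a)) (≗⇒≈ (Q^-+ a 1))

    jacobiProduct-one : ∀ N → jacobiProduct one N ≈ poch 1ℤ d d₂ N ⊛ poch 1ℤ d d₂ N
    jacobiProduct-one zero    = solve 0 (:1 := :1 :* :1) ≈-refl
    jacobiProduct-one (suc N) = begin
      jacobiProduct one N ⊛ ((y +ˢ one) ⊛ (one +ˢ y ⊛ one))
        ≈⟨ ⊛-cong (jacobiProduct-one N) (≈-refl {(y +ˢ one) ⊛ (one +ˢ y ⊛ one)}) ⟩
      (P ⊛ P) ⊛ ((y +ˢ one) ⊛ (one +ˢ y ⊛ one))
        ≈⟨ solve 2 (λ x p → (p :* p) :* ((x :+ :1) :* (:1 :+ x :* :1)) := (p :* (:1 :+ :1 :* x)) :* (p :* (:1 :+ :1 :* x)))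
             ≈-refl y P ⟩
      (P ⊛ (one +ˢ one ⊛ y)) ⊛ (P ⊛ (one +ˢ one ⊛ y))
        ≈⟨ substitute 2 (λ p x → (p :* (:1 :+ :1 :* x)) :* (p :* (:1 :+ :1 :* x))) (≈-refl {P} ∷ ≡⇒≈ (q ^ˢ_) exponent ∷ []) ⟩
      poch 1ℤ d d₂ (suc N) ⊛ poch 1ℤ d d₂ (suc N) ∎
      where
      y = Q^ (suc (N +ℕ N))
      P = poch 1ℤ d d₂ N
      exponent : d *ℕ suc (N +ℕ N) ≡ d +ℕ d₂ *ℕ N
      exponent = trans (ℕ.*-suc d (N +ℕ N)) (cong (d +ℕ_) (trans (ℕ.*-distribˡ-+ d N N) (sym (ℕ.*-distribʳ-+ N d d))))

    jacobiProduct-Q : ∀ N → jacobiProduct (Q^ 1) N ≈ Q^ N ⊛ (poch 1ℤ 0 d₂ N ⊛ poch 1ℤ d₂ d₂ N)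
    jacobiProduct-Q zero    = ≈-trans (solve 0 (:1 := :1 :* (:1 :* :1)) ≈-refl)
      (substitute 1 (λ x → x :* (:1 :* :1)) (≗⇒≈ (λ n → sym (Q^-zero n)) ∷ []))
    jacobiProduct-Q (suc N) = begin
      jacobiProduct (Q^ 1) N ⊛ ((Q^ (suc 2N) +ˢ x) ⊛ (one +ˢ Q^ (suc 2N) ⊛ x))
        ≈⟨ substitute 3 (λ j y x → j :* ((y :+ x) :* (:1 :+ y :* x)))
             (jacobiProduct-Q N ∷ ≈-trans (Q^-suc 2N) (≈-refl {z ⊛ x}) ∷ ≈-refl {x} ∷ []) ⟩
      (Q^ N ⊛ (A ⊛ B)) ⊛ ((z ⊛ x +ˢ x) ⊛ (one +ˢ (z ⊛ x) ⊛ x))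
        ≈⟨ solve 5 (λ x z xᴺ a b → (xᴺ :* (a :* b)) :* ((z :* x :+ x) :* (:1 :+ (z :* x) :* x))
                      := (xᴺ :* x) :* ((a :* (:1 :+ :1 :* z)) :* (b :* (:1 :+ :1 :* ((z :* x) :* x)))))
             ≈-refl x z (Q^ N) A B ⟩
      (Q^ N ⊛ x) ⊛ ((A ⊛ (one +ˢ one ⊛ z)) ⊛ (B ⊛ (one +ˢ one ⊛ ((z ⊛ x) ⊛ x))))
        ≈⟨ substitute 5 (λ xᴺ⁺¹ a z b w → xᴺ⁺¹ :* ((a :* (:1 :+ :1 :* z)) :* (b :* (:1 :+ :1 :* w))))
             (≈-sym (Q^-suc N) ∷ ≈-refl {A} ∷ ≗⇒≈ (λ n → sym (T^≗Q^ N n)) ∷ ≈-refl {B} ∷ ≈-sym T^[1+N] ∷ []) ⟩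
      Q^ (suc N) ⊛ (poch 1ℤ 0 d₂ (suc N) ⊛ poch 1ℤ d₂ d₂ (suc N)) ∎
      where
      2N = N +ℕ N
      x  = Q^ 1
      z  = Q^ 2N
      A  = poch 1ℤ 0 d₂ N
      B  = poch 1ℤ d₂ d₂ N
      T^[1+N] : q ^ˢ (d₂ +ℕ d₂ *ℕ N) ≈ (z ⊛ x) ⊛ x
      T^[1+N] = ≈-trans (≡⇒≈ (q ^ˢ_) (sym (ℕ.*-suc d₂ N))) (≈-trans (≗⇒≈ (T^≗Q^ (suc N)))
        (≈-trans (≡⇒≈ Q^_ (cong suc (ℕ.+-suc N N))) (≈-trans (Q^-suc (suc 2N)) (⊛-cong (Q^-suc 2N) (≈-refl {x})))))

poch-constant-term : ∀ σ b s N → 1 ≤ b → poch σ b s N 0 ≡ 1ℤ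
poch-constant-term σ b s zero    _   = refl
poch-constant-term σ b s (suc N) 1≤b = cong₂ _*_ (poch-constant-term σ b s N 1≤b)
  (cong (_+_ 1ℤ) (trans (⊛-comm (ι σ) (q ^ˢ e) 0) (q^⊛-below e (ι σ) 0 (ℕ.≤-trans 1≤b (ℕ.m≤m+n b _)))))
  where e = b +ℕ s *ℕ N

one-^ˢ : ∀ j → one ^ˢ j ≗ one
one-^ˢ zero    n = refl
one-^ˢ (suc j) n = trans (⊛-congʳ one (one-^ˢ j) n) (⊛-identityˡ one n)

module JacobiLimit (d : ℕ) (1≤d : 1 ≤ d) where
  open JacobiTripleProduct d public

  TT-constant-term : ∀ N → TT N 0 ≡ 1ℤ
  TT-constant-term N = poch-constant-term -1ℤ d₂ d₂ N (ℕ.≤-trans 1≤d (ℕ.m≤m+n d d))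

  Q^1-^ˢ : ∀ j → (Q^ 1) ^ˢ j ≗ Q^ j
  Q^1-^ˢ j n = trans (sym (^ˢ-* q (d *ℕ 1) j n)) (cong (λ e → (q ^ˢ (e *ℕ j)) n) (ℕ.*-identityʳ d))

  -- Both sides agree with (T;T)_m below T^(m+1): [2N choose j] (T;T)_j (T;T)_(2N-j) = (T;T)_2N.
  gauss-limit : ∀ N j j′ m → j +ℕ j′ ≡ N +ℕ N → m ≤ j → m ≤ j′ → m ≤ N →
    gauss N j ⊛ (TT N ⊛ TT N) ≈[ d₂ +ℕ d₂ *ℕ m ] TT N
  gauss-limit N j j′ m j+j′≡2N m≤j m≤j′ m≤N = begin
    gauss N j ⊛ (TT N ⊛ TT N)
      ≈⟨ ⊛-cong (≈-refl {gauss N j}) (⊛-cong (close m≤N m≤j) (≈-trans (close m≤N m≤j′) (≡⇒≈ TT j′≡2N∸j))) ⟩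
    gauss N j ⊛ (TT j ⊛ TT (2N ∸ j))
      ≈⟨ ≗⇒≈ (λ n → sym (⊛-assoc (gauss N j) (TT j) (TT (2N ∸ j)) n)) ⟩
    (gauss N j ⊛ TT j) ⊛ TT (2N ∸ j)
      ≈⟨ gauss-product R N j (subst (j ≤_) j+j′≡2N (ℕ.m≤m+n j j′)) ⟩
    TT 2N
      ≈⟨ close (ℕ.≤-trans m≤N (ℕ.m≤m+n N N)) m≤N ⟩
    TT N ∎
    where
    R = d₂ +ℕ d₂ *ℕ m
    2N = N +ℕ N
    open Truncated.≈-Reasoning R
    close : ∀ {a b} → m ≤ a → m ≤ b → TT a ≈[ R ] TT b
    close m≤a m≤b = ≈-trans (poch-stable -1ℤ d₂ d₂ m≤a) (≈-sym (poch-stable -1ℤ d₂ d₂ m≤b))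
    j′≡2N∸j : j′ ≡ 2N ∸ j
    j′≡2N∸j = sym (trans (cong (_∸ j) (sym j+j′≡2N)) (ℕ.m+n∸m≡n j j′))

  term-limit : ∀ e N j j′ m → j +ℕ j′ ≡ N +ℕ N → m ≤ j → m ≤ j′ → m ≤ N →
    (Q^ e ⊛ jacobiTerm N j) ⊛ (TT N ⊛ TT N) ≈[ d *ℕ (e +ℕ (sqDist j N +ℕ (suc m +ℕ suc m))) ] Q^ (e +ℕ sqDist j N) ⊛ TT N
  term-limit e N j j′ m j+j′≡2N m≤j m≤j′ m≤N n n<prec = begin
    ((Q^ e ⊛ (Q^ s ⊛ g)) ⊛ P²) n     ≡⟨ ⊛-assoc (Q^ e) (Q^ s ⊛ g) P² n ⟩
    (Q^ e ⊛ ((Q^ s ⊛ g) ⊛ P²)) n     ≡⟨ ⊛-congʳ (Q^ e) (⊛-assoc (Q^ s) g P²) n ⟩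
    (Q^ e ⊛ (Q^ s ⊛ (g ⊛ P²))) n     ≡⟨ sym (⊛-assoc (Q^ e) (Q^ s) (g ⊛ P²) n) ⟩
    ((Q^ e ⊛ Q^ s) ⊛ (g ⊛ P²)) n     ≡⟨ ⊛-congˡ (g ⊛ P²) (λ k → sym (Q^-+ e s k)) n ⟩
    (Q^ (e +ℕ s) ⊛ (g ⊛ P²)) n       ≡⟨ q^⊛-cong (d *ℕ (e +ℕ s)) (gauss-limit N j j′ m j+j′≡2N m≤j m≤j′ m≤N) n
                                          (subst (n <_) (precision d e s m) n<prec) ⟩
    (Q^ (e +ℕ s) ⊛ TT N) n           ∎
    where
    open ≡-Reasoning
    s  = sqDist j N
    g  = gauss N j
    P² = TT N ⊛ TT N
    precision : ∀ d e s m → d *ℕ (e +ℕ (s +ℕ (suc m +ℕ suc m))) ≡ d *ℕ (e +ℕ s) +ℕ ((d +ℕ d) +ℕ (d +ℕ d) *ℕ m)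
    precision = solve-∀

  term-limit₀ : ∀ N j → j ≤ N +ℕ N →
    (Q^ 0 ⊛ jacobiTerm N j) ⊛ (TT N ⊛ TT N) ≈[ d *ℕ suc N ] Q^ (sqDist j N) ⊛ TT N
  term-limit₀ N j j≤2N with position N j j≤2N
  ... | left m k = ≈-lower (ℕ.*-monoʳ-≤ d
          (subst (λ s → suc (m +ℕ k) ≤ s +ℕ (suc m +ℕ suc m)) (sym (sqDist-+ʳ m k)) (limit-precision₀ m k)))
        (term-limit 0 (m +ℕ k) m (m +ℕ k +ℕ k) m (left-sum m k) ℕ.≤-refl (m≤m+k+k m k) (ℕ.m≤m+n m k))
  ... | right m k = ≈-lower (ℕ.*-monoʳ-≤ d
          (subst (λ s → suc (m +ℕ k) ≤ s +ℕ (suc m +ℕ suc m)) (sym (sqDist-+ˡ (m +ℕ k) k)) (limit-precision₀ m k)))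
        (term-limit 0 (m +ℕ k) (m +ℕ k +ℕ k) m m (right-sum m k) (m≤m+k+k m k) ℕ.≤-refl (ℕ.m≤m+n m k))

  term-limit₁ : ∀ N j → j ≤ N +ℕ N →
    (Q^ j ⊛ jacobiTerm N j) ⊛ (TT N ⊛ TT N) ≈[ d *ℕ suc (N +ℕ N) ] Q^ (j +ℕ sqDist j N) ⊛ TT N
  term-limit₁ N j j≤2N with position N j j≤2N
  ... | left m k = ≈-lower (ℕ.*-monoʳ-≤ d
          (subst (λ s → suc ((m +ℕ k) +ℕ (m +ℕ k)) ≤ m +ℕ (s +ℕ (suc m +ℕ suc m))) (sym (sqDist-+ʳ m k)) (limit-precision₁ m k)))
        (term-limit m (m +ℕ k) m (m +ℕ k +ℕ k) m (left-sum m k) ℕ.≤-refl (m≤m+k+k m k) (ℕ.m≤m+n m k))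
  ... | right m k = ≈-lower (ℕ.*-monoʳ-≤ d
          (subst (λ s → suc ((m +ℕ k) +ℕ (m +ℕ k)) ≤ (m +ℕ k +ℕ k) +ℕ (s +ℕ (suc m +ℕ suc m))) (sym (sqDist-+ˡ (m +ℕ k) k))
            (ℕ.≤-trans (limit-precision₁ m k) (ℕ.+-monoˡ-≤ _ (m≤m+k+k m k)))))
        (term-limit (m +ℕ k +ℕ k) (m +ℕ k) (m +ℕ k +ℕ k) m m (right-sum m k) (m≤m+k+k m k) ℕ.≤-refl (ℕ.m≤m+n m k))

  -- Σ_{j ≤ 2N} Q^((j - N)²), truncating θ(Q) = Σ_{n ∈ ℤ} Q^(n²)
  theta : ℕ → Series
  theta N = sumˢ (λ j → Q^ (sqDist j N)) (N +ℕ N)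

  -- Σ_{j ≤ 2N} Q^((j - N)² + (j - N)), truncating Σ_{n ∈ ℤ} Q^(n(n+1))
  theta₂ : ℕ → Series
  theta₂ N = sumˢ (λ j → Q^ ((j +ℕ sqDist j N) ∸ N)) (N +ℕ N)

  theta-poch : ∀ N → theta N ≈[ d *ℕ suc N ] (poch 1ℤ d d₂ N ⊛ poch 1ℤ d d₂ N) ⊛ TT N
  theta-poch N = ≈-sym (⊛-cancelʳ (TT N) (TT-constant-term N) (begin
    ((A ⊛ A) ⊛ TT N) ⊛ TT N
      ≈⟨ solve 2 (λ a p → ((a :* a) :* p) :* p := (a :* a) :* (p :* p)) ≈-refl A (TT N) ⟩
    (A ⊛ A) ⊛ P²
      ≈⟨ ⊛-cong (≈-sym (≈-trans (jacobi-finite R one N) (jacobiProduct-one R N))) (≈-refl {P²}) ⟩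
    jacobiSum one N ⊛ P²
      ≈⟨ ≗⇒≈ (λ n → trans (⊛-comm (jacobiSum one N) P² n) (⊛-sumˢ P² (jacobiSummand one N) (N +ℕ N) n)) ⟩
    sumˢ (λ j → P² ⊛ jacobiSummand one N j) (N +ℕ N)
      ≈⟨ sumˢ-cong (N +ℕ N) term ⟩
    sumˢ (λ j → TT N ⊛ Q^ (sqDist j N)) (N +ℕ N)
      ≈⟨ ≗⇒≈ (λ n → trans (sym (⊛-sumˢ (TT N) (λ j → Q^ (sqDist j N)) (N +ℕ N) n)) (⊛-comm (TT N) (theta N) n)) ⟩
    theta N ⊛ TT N ∎))
    where
    R = d *ℕ suc N
    A = poch 1ℤ d d₂ N
    P² = TT N ⊛ TT N
    open Truncated R
    open ≈-Reasoning
    term : ∀ j → j ≤ N +ℕ N → P² ⊛ jacobiSummand one N j ≈ TT N ⊛ Q^ (sqDist j N)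
    term j j≤2N = begin
      P² ⊛ (one ^ˢ j ⊛ jacobiTerm N j)
        ≈⟨ ⊛-cong (≈-refl {P²}) (⊛-cong (≗⇒≈ (λ n → trans (one-^ˢ j n) (sym (Q^-zero n)))) (≈-refl {jacobiTerm N j})) ⟩
      P² ⊛ (Q^ 0 ⊛ jacobiTerm N j)
        ≈⟨ ≗⇒≈ (⊛-comm P² (Q^ 0 ⊛ jacobiTerm N j)) ⟩
      (Q^ 0 ⊛ jacobiTerm N j) ⊛ P²
        ≈⟨ term-limit₀ N j j≤2N ⟩
      Q^ (sqDist j N) ⊛ TT N
        ≈⟨ ≗⇒≈ (⊛-comm (Q^ (sqDist j N)) (TT N)) ⟩
      TT N ⊛ Q^ (sqDist j N) ∎

  theta₂-poch : ∀ N → theta₂ N ≈[ d *ℕ suc N ] (poch 1ℤ 0 d₂ N ⊛ poch 1ℤ d₂ d₂ N) ⊛ TT N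
  theta₂-poch N = ≈-sym (⊛-cancelʳ (TT N) (TT-constant-term N)
    (q^⊛-cancel (d *ℕ N) (λ n n<prec → shifted n (subst (n <_) precision n<prec))))
    where
    R = d *ℕ suc (N +ℕ N)
    B = poch 1ℤ 0 d₂ N ⊛ poch 1ℤ d₂ d₂ N
    P² = TT N ⊛ TT N
    e₂ = λ j → (j +ℕ sqDist j N) ∸ N
    precision : d *ℕ N +ℕ d *ℕ suc N ≡ R
    precision = trans (sym (ℕ.*-distribˡ-+ d N (suc N))) (cong (d *ℕ_) (ℕ.+-suc N N))
    open Truncated R
    open ≈-Reasoning
    term : ∀ j → j ≤ N +ℕ N → P² ⊛ jacobiSummand (Q^ 1) N j ≈ (Q^ N ⊛ TT N) ⊛ Q^ (e₂ j)
    term j j≤2N = begin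
      P² ⊛ ((Q^ 1) ^ˢ j ⊛ jacobiTerm N j)
        ≈⟨ ⊛-cong (≈-refl {P²}) (⊛-cong (≗⇒≈ (Q^1-^ˢ j)) (≈-refl {jacobiTerm N j})) ⟩
      P² ⊛ (Q^ j ⊛ jacobiTerm N j)
        ≈⟨ ≗⇒≈ (⊛-comm P² (Q^ j ⊛ jacobiTerm N j)) ⟩
      (Q^ j ⊛ jacobiTerm N j) ⊛ P²
        ≈⟨ term-limit₁ N j j≤2N ⟩
      Q^ (j +ℕ sqDist j N) ⊛ TT N
        ≈⟨ ⊛-cong (≈-trans (≡⇒≈ Q^_ (sym (ℕ.m+[n∸m]≡n (N≤j+sqDist N j)))) (≗⇒≈ (Q^-+ N (e₂ j)))) (≈-refl {TT N}) ⟩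
      (Q^ N ⊛ Q^ (e₂ j)) ⊛ TT N
        ≈⟨ solve 3 (λ x e p → (x :* e) :* p := (x :* p) :* e) ≈-refl (Q^ N) (Q^ (e₂ j)) (TT N) ⟩
      (Q^ N ⊛ TT N) ⊛ Q^ (e₂ j) ∎
    shifted : Q^ N ⊛ ((B ⊛ TT N) ⊛ TT N) ≈ Q^ N ⊛ (theta₂ N ⊛ TT N)
    shifted = begin
      Q^ N ⊛ ((B ⊛ TT N) ⊛ TT N)
        ≈⟨ solve 3 (λ x b p → x :* ((b :* p) :* p) := (x :* b) :* (p :* p)) ≈-refl (Q^ N) B (TT N) ⟩
      (Q^ N ⊛ B) ⊛ P²
        ≈⟨ ⊛-cong (≈-sym (≈-trans (jacobi-finite R (Q^ 1) N) (jacobiProduct-Q R N))) (≈-refl {P²}) ⟩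
      jacobiSum (Q^ 1) N ⊛ P²
        ≈⟨ ≗⇒≈ (λ n → trans (⊛-comm (jacobiSum (Q^ 1) N) P² n) (⊛-sumˢ P² (jacobiSummand (Q^ 1) N) (N +ℕ N) n)) ⟩
      sumˢ (λ j → P² ⊛ jacobiSummand (Q^ 1) N j) (N +ℕ N)
        ≈⟨ sumˢ-cong (N +ℕ N) term ⟩
      sumˢ (λ j → (Q^ N ⊛ TT N) ⊛ Q^ (e₂ j)) (N +ℕ N)
        ≈⟨ ≗⇒≈ (λ n → sym (⊛-sumˢ (Q^ N ⊛ TT N) (λ j → Q^ (e₂ j)) (N +ℕ N) n)) ⟩
      (Q^ N ⊛ TT N) ⊛ theta₂ N
        ≈⟨ solve 3 (λ x p t → (x :* p) :* t := x :* (t :* p)) ≈-refl (Q^ N) (TT N) (theta₂ N) ⟩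
      Q^ N ⊛ (theta₂ N ⊛ TT N) ∎

module PochhammerIdentities (M : ℕ) where
  open Truncated M
  open ≈-Reasoning

  poch-plus-minus : ∀ b s N → poch 1ℤ b s N ⊛ poch -1ℤ b s N ≈ poch -1ℤ (b +ℕ b) (s +ℕ s) N
  poch-plus-minus b s zero    = solve 0 (:1 :* :1 := :1) ≈-refl
  poch-plus-minus b s (suc N) = begin
    (poch 1ℤ b s N ⊛ factor 1ℤ e) ⊛ (poch -1ℤ b s N ⊛ factor -1ℤ e)
      ≈⟨ solve 3 (λ p m x → (p :* (:1 :+ :1 :* x)) :* (m :* (1- x)) := (p :* m) :* (1- (x :* x)))
           ≈-refl (poch 1ℤ b s N) (poch -1ℤ b s N) (q ^ˢ e) ⟩
    (poch 1ℤ b s N ⊛ poch -1ℤ b s N) ⊛ oneMinus (q ^ˢ e ⊛ q ^ˢ e)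
      ≈⟨ substitute 2 (λ p x → p :* (1- x))
           (poch-plus-minus b s N ∷ ≈-trans (≗⇒≈ (λ n → sym (^ˢ-+ q e e n))) (≡⇒≈ (q ^ˢ_) e+e≡) ∷ []) ⟩
    poch -1ℤ (b +ℕ b) (s +ℕ s) N ⊛ factor -1ℤ ((b +ℕ b) +ℕ (s +ℕ s) *ℕ N) ∎
    where
    e = b +ℕ s *ℕ N
    e+e≡ : e +ℕ e ≡ (b +ℕ b) +ℕ (s +ℕ s) *ℕ N
    e+e≡ = double-exponent b s N

  poch-split : ∀ σ b N → poch σ b b (N +ℕ N) ≈ poch σ b (b +ℕ b) N ⊛ poch σ (b +ℕ b) (b +ℕ b) N
  poch-split σ b zero    = solve 0 (:1 := :1 :* :1) ≈-refl
  poch-split σ b (suc N) = begin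
    poch σ b b (suc N +ℕ suc N)
      ≈⟨ ≡⇒≈ (poch σ b b) (cong suc (ℕ.+-suc N N)) ⟩
    (poch σ b b (N +ℕ N) ⊛ factor σ (b +ℕ b *ℕ (N +ℕ N))) ⊛ factor σ (b +ℕ b *ℕ suc (N +ℕ N))
      ≈⟨ substitute 3 (λ p x y → (p :* x) :* y)
           (poch-split σ b N ∷ ≡⇒≈ (factor σ) (odd-exponent b N) ∷ ≡⇒≈ (factor σ) (even-exponent b N) ∷ []) ⟩
    ((poch σ b (b +ℕ b) N ⊛ poch σ (b +ℕ b) (b +ℕ b) N) ⊛ x) ⊛ y
      ≈⟨ solve 4 (λ p p′ x y → ((p :* p′) :* x) :* y := (p :* x) :* (p′ :* y)) ≈-refl
           (poch σ b (b +ℕ b) N) (poch σ (b +ℕ b) (b +ℕ b) N) x y ⟩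
    poch σ b (b +ℕ b) (suc N) ⊛ poch σ (b +ℕ b) (b +ℕ b) (suc N) ∎
    where
    x = factor σ (b +ℕ (b +ℕ b) *ℕ N)
    y = factor σ ((b +ℕ b) +ℕ (b +ℕ b) *ℕ N)
    odd-exponent : ∀ b N → b +ℕ b *ℕ (N +ℕ N) ≡ b +ℕ (b +ℕ b) *ℕ N
    odd-exponent = solve-∀
    even-exponent : ∀ b N → b +ℕ b *ℕ suc (N +ℕ N) ≡ (b +ℕ b) +ℕ (b +ℕ b) *ℕ N
    even-exponent = solve-∀

  poch-zero-suc : ∀ σ s N → poch σ 0 s (suc N) ≈ factor σ 0 ⊛ poch σ s s N
  poch-zero-suc σ s zero    = ≈-trans (⊛-cong (≈-refl {one}) (≡⇒≈ (factor σ) (ℕ.*-zeroʳ s)))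
    (solve 1 (λ x → :1 :* x := x :* :1) ≈-refl (factor σ 0))
  poch-zero-suc σ s (suc N) = begin
    poch σ 0 s (suc N) ⊛ factor σ (s *ℕ suc N)
      ≈⟨ ⊛-cong (poch-zero-suc σ s N) (≡⇒≈ (factor σ) (ℕ.*-suc s N)) ⟩
    (factor σ 0 ⊛ poch σ s s N) ⊛ factor σ (s +ℕ s *ℕ N)
      ≈⟨ ≗⇒≈ (⊛-assoc (factor σ 0) (poch σ s s N) (factor σ (s +ℕ s *ℕ N))) ⟩
    factor σ 0 ⊛ poch σ s s (suc N) ∎

  factor-one-zero : factor 1ℤ 0 ≈ ι (+ 2)
  factor-one-zero zero    _ = refl
  factor-one-zero (suc n) _ = cong (_+_ (+ 0)) (⊛-identityˡ one (suc n))

module EtaQuotients (d : ℕ) (1≤d : 1 ≤ d) where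
  open JacobiLimit d 1≤d public

  private
    d≤d₂ : d ≤ d₂
    d≤d₂ = ℕ.m≤m+n d d
    d≤4d : d ≤ d₂ +ℕ d₂
    d≤4d = ℕ.≤-trans d≤d₂ (ℕ.m≤m+n d₂ d₂)

  f≈poch-below : ∀ k N N′ → d ≤ k → N ≤ N′ → f k ≈[ d *ℕ suc N ] poch -1ℤ k k N′
  f≈poch-below k N N′ d≤k N≤N′ =
    ≈-lower (ℕ.*-mono-≤ d≤k (s≤s N≤N′)) (f≈poch k N′ (ℕ.≤-trans 1≤d d≤k))

  theta-eta : ∀ N → (theta N ⊛ f d ^ˢ 2) ⊛ f (d₂ +ℕ d₂) ^ˢ 2 ≈[ d *ℕ suc N ] f d₂ ^ˢ 5
  theta-eta N = begin
    (theta N ⊛ f d ^ˢ 2) ⊛ f (d₂ +ℕ d₂) ^ˢ 2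
      ≈⟨ substitute 3 (λ t a b → (t :* (a :^ 2)) :* (b :^ 2)) (theta-poch N ∷ f[d] ∷ f[4d] ∷ []) ⟩
    (((A ⊛ A) ⊛ C) ⊛ (B ⊛ C) ^ˢ 2) ⊛ D ^ˢ 2
      ≈⟨ solve 4 (λ a b c e → (((a :* a) :* c) :* ((b :* c) :^ 2)) :* (e :^ 2) := (((a :* b) :* e) :^ 2) :* (c :^ 3))
           ≈-refl A B C D ⟩
    ((A ⊛ B) ⊛ D) ^ˢ 2 ⊛ C ^ˢ 3
      ≈⟨ substitute 2 (λ x y → (x :^ 2) :* (y :^ 3)) (≈-sym f[2d]′ ∷ ≈-sym f[2d] ∷ []) ⟩
    f d₂ ^ˢ 2 ⊛ f d₂ ^ˢ 3
      ≈⟨ solve 1 (λ x → (x :^ 2) :* (x :^ 3) := x :^ 5) ≈-refl (f d₂) ⟩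
    f d₂ ^ˢ 5 ∎
    where
    open Truncated (d *ℕ suc N)
    open PochhammerIdentities (d *ℕ suc N)
    open ≈-Reasoning
    A = poch 1ℤ d d₂ N
    B = poch -1ℤ d d₂ N
    C = TT N
    D = poch -1ℤ (d₂ +ℕ d₂) (d₂ +ℕ d₂) N
    f[d] : f d ≈ B ⊛ C
    f[d] = ≈-trans (f≈poch-below d N (N +ℕ N) ℕ.≤-refl (ℕ.m≤m+n N N)) (poch-split -1ℤ d N)
    f[4d] : f (d₂ +ℕ d₂) ≈ D
    f[4d] = f≈poch-below (d₂ +ℕ d₂) N N d≤4d ℕ.≤-refl
    f[2d] : f d₂ ≈ C
    f[2d] = f≈poch-below d₂ N N d≤d₂ ℕ.≤-refl
    f[2d]′ : f d₂ ≈ (A ⊛ B) ⊛ D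
    f[2d]′ = ≈-trans (f≈poch-below d₂ N (N +ℕ N) d≤d₂ (ℕ.m≤m+n N N))
      (≈-trans (poch-split -1ℤ d₂ N) (⊛-cong (≈-sym (poch-plus-minus d d₂ N)) (≈-refl {D})))

  theta₂-eta : ∀ N → theta₂ (suc N) ⊛ f d₂ ≈[ d *ℕ suc (suc N) ] ι (+ 2) ⊛ f (d₂ +ℕ d₂) ^ˢ 2
  theta₂-eta N = begin
    theta₂ (suc N) ⊛ f d₂
      ≈⟨ ⊛-cong (theta₂-poch (suc N)) f[2d] ⟩
    ((B₀ ⊛ B) ⊛ C) ⊛ C
      ≈⟨ substitute 3 (λ b₀ b c → ((b₀ :* b) :* c) :* c) (B₀≈2B ∷ ≈-refl {B} ∷ ≈-refl {C} ∷ []) ⟩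
    (((ι (+ 2) ⊛ B) ⊛ B) ⊛ C) ⊛ C
      ≈⟨ solve 2 (λ b c → (((con (+ 2) :* b) :* b) :* c) :* c := con (+ 2) :* ((b :* c) :^ 2)) ≈-refl B C ⟩
    ι (+ 2) ⊛ (B ⊛ C) ^ˢ 2
      ≈⟨ substitute 1 (λ x → con (+ 2) :* (x :^ 2)) (≈-trans (poch-plus-minus d₂ d₂ (suc N)) (≈-sym f[4d]) ∷ []) ⟩
    ι (+ 2) ⊛ f (d₂ +ℕ d₂) ^ˢ 2 ∎
    where
    R = d *ℕ suc (suc N)
    open Truncated R
    open PochhammerIdentities R
    open ≈-Reasoning
    B₀ = poch 1ℤ 0 d₂ (suc N)
    B  = poch 1ℤ d₂ d₂ (suc N)
    C  = TT (suc N)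
    f[2d] : f d₂ ≈ C
    f[2d] = f≈poch-below d₂ (suc N) (suc N) d≤d₂ ℕ.≤-refl
    f[4d] : f (d₂ +ℕ d₂) ≈ poch -1ℤ (d₂ +ℕ d₂) (d₂ +ℕ d₂) (suc N)
    f[4d] = f≈poch-below (d₂ +ℕ d₂) (suc N) (suc N) d≤4d ℕ.≤-refl
    R≤d₂+d₂N : R ≤ d₂ +ℕ d₂ *ℕ N
    R≤d₂+d₂N = ℕ.≤-trans (ℕ.*-monoʳ-≤ d (s≤s (s≤s (ℕ.m≤m+n N N)))) (ℕ.≤-reflexive (expand d N))
      where
      expand : ∀ d N → d *ℕ suc (suc (N +ℕ N)) ≡ (d +ℕ d) +ℕ (d +ℕ d) *ℕ N
      expand = solve-∀
    B₀≈2B : B₀ ≈ ι (+ 2) ⊛ B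
    B₀≈2B = ≈-trans (poch-zero-suc 1ℤ d₂ N)
      (⊛-cong factor-one-zero (≈-lower R≤d₂+d₂N (≈-sym (poch-stable 1ℤ d₂ d₂ (ℕ.n≤1+n N)))))

sumˢ-even-odd : ∀ g K → sumˢ g (K +ℕ K) +ˢ g (suc (K +ℕ K)) ≗ sumˢ (λ i → g (i +ℕ i)) K +ˢ sumˢ (λ i → g (suc (i +ℕ i))) K
sumˢ-even-odd g zero    n = refl
sumˢ-even-odd g (suc K) n = begin
  sumˢ g (suc K +ℕ suc K) n + g (suc (suc K +ℕ suc K)) n
    ≡⟨ cong (λ m → sumˢ g m n + g (suc m) n) 2K+2≡ ⟩
  ((sumˢ g (K +ℕ K) n + g (suc (K +ℕ K)) n) + g (suc (suc (K +ℕ K))) n) + g (suc (suc (suc (K +ℕ K)))) n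
    ≡⟨ ℤ.+-assoc (sumˢ g (K +ℕ K) n + g (suc (K +ℕ K)) n) _ _ ⟩
  (sumˢ g (K +ℕ K) n + g (suc (K +ℕ K)) n) + (g (suc (suc (K +ℕ K))) n + g (suc (suc (suc (K +ℕ K)))) n)
    ≡⟨ cong₂ _+_ (sumˢ-even-odd g K n) (cong (λ m → g m n + g (suc m) n) (sym 2K+2≡)) ⟩
  (sumˢ (λ i → g (i +ℕ i)) K n + sumˢ (λ i → g (suc (i +ℕ i))) K n) + (g (suc K +ℕ suc K) n + g (suc (suc K +ℕ suc K)) n)
    ≡⟨ +-interchange (sumˢ (λ i → g (i +ℕ i)) K n) _ _ _ ⟩
  sumˢ (λ i → g (i +ℕ i)) (suc K) n + sumˢ (λ i → g (suc (i +ℕ i))) (suc K) n ∎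
  where
  open ≡-Reasoning
  2K+2≡ : suc K +ℕ suc K ≡ suc (suc (K +ℕ K))
  2K+2≡ = cong suc (ℕ.+-suc K K)

module E₁ = EtaQuotients 1 (s≤s z≤n)
module E₄ = EtaQuotients 4 (s≤s z≤n)

-- Split by the parity of j: (2i - 2N)² = 4 (i - N)² and (2i + 1 - 2N)² = 1 + 4 ((i - N)² + (i - N)).
theta-dissection : ∀ N → E₁.theta (N +ℕ N) ≈[ suc (N +ℕ N) ] E₄.theta N +ˢ q ⊛ E₄.theta₂ N
theta-dissection N = begin
  E₁.theta K
    ≈⟨ ≗⇒≈ (λ n → sym (ℤ.+-identityʳ (E₁.theta K n))) ⟩
  E₁.theta K +ˢ 0ˢ
    ≈⟨ +-cong (≈-refl {E₁.theta K}) (≈-sym last-term-vanishes) ⟩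
  E₁.theta K +ˢ g (suc (K +ℕ K))
    ≈⟨ ≗⇒≈ (sumˢ-even-odd g K) ⟩
  sumˢ (λ i → g (i +ℕ i)) K +ˢ sumˢ (λ i → g (suc (i +ℕ i))) K
    ≈⟨ +-cong (sumˢ-cong K (λ i _ → ≡⇒≈ (q ^ˢ_) (trans (ℕ.*-identityˡ _) (sqDist-even i N))))
              (≈-trans (sumˢ-cong K (λ i _ → ≡⇒≈ (q ^ˢ_) (trans (ℕ.*-identityˡ _) (sqDist-odd i N))))
                       (≗⇒≈ (λ n → sym (⊛-sumˢ q _ K n)))) ⟩
  E₄.theta N +ˢ q ⊛ E₄.theta₂ N ∎
  where
  K = N +ℕ N
  g = λ j → q ^ˢ (1 *ℕ sqDist j K)
  open Truncated (suc K)
  open ≈-Reasoning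
  last-term-vanishes : g (suc (K +ℕ K)) ≈ 0ˢ
  last-term-vanishes = ≈-lower (ℕ.≤-trans (k≤k*k (suc K)) (ℕ.≤-reflexive (sym exponent))) (q^≈0ˢ _)
    where
    exponent : 1 *ℕ sqDist (suc (K +ℕ K)) K ≡ suc K *ℕ suc K
    exponent = trans (ℕ.*-identityˡ _)
      (trans (cong (λ j → sqDist j K) (sym (ℕ.+-suc K K))) (sqDist-+ˡ K (suc K)))

main-identity : ∀ N → (f 2 ^ˢ 5 ⊛ f 8) ⊛ f 16 ^ˢ 2
  ≈[ suc (suc N +ℕ suc N) ] f 1 ^ˢ 2 ⊛ f 8 ^ˢ 6 +ˢ q ⊛ (((f 1 ^ˢ 2 ⊛ f 4 ^ˢ 2) ⊛ f 16 ^ˢ 2) ⊛ (ι (+ 2) ⊛ f 16 ^ˢ 2))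
main-identity N′ = begin
  (f 2 ^ˢ 5 ⊛ f 8) ⊛ f 16 ^ˢ 2
    ≈⟨ substitute 3 (λ x y z → (x :* y) :* (z :^ 2))
         (≈-sym (≈-lower (ℕ.≤-reflexive (sym (ℕ.*-identityˡ P))) (E₁.theta-eta K)) ∷ ≈-refl {f 8} ∷ ≈-refl {f 16} ∷ []) ⟩
  (((θ ⊛ f 1 ^ˢ 2) ⊛ f 4 ^ˢ 2) ⊛ f 8) ⊛ f 16 ^ˢ 2
    ≈⟨ substitute 5 (λ t a b c e → (((t :* (a :^ 2)) :* (b :^ 2)) :* c) :* (e :^ 2))
         (theta-dissection N ∷ ≈-refl {f 1} ∷ ≈-refl {f 4} ∷ ≈-refl {f 8} ∷ ≈-refl {f 16} ∷ []) ⟩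
  (((θ₄ +ˢ q ⊛ θ₂) ⊛ f 1 ^ˢ 2) ⊛ f 4 ^ˢ 2 ⊛ f 8) ⊛ f 16 ^ˢ 2
    ≈⟨ solve 7 (λ t₄ x t₂ a b c e → ((((t₄ :+ x :* t₂) :* (a :^ 2)) :* (b :^ 2)) :* c) :* (e :^ 2)
                 := (a :^ 2) :* (c :* ((t₄ :* (b :^ 2)) :* (e :^ 2))) :+ x :* ((((a :^ 2) :* (b :^ 2)) :* (e :^ 2)) :* (t₂ :* c)))
         ≈-refl θ₄ q θ₂ (f 1) (f 4) (f 8) (f 16) ⟩
  f 1 ^ˢ 2 ⊛ (f 8 ⊛ ((θ₄ ⊛ f 4 ^ˢ 2) ⊛ f 16 ^ˢ 2)) +ˢ q ⊛ (((f 1 ^ˢ 2 ⊛ f 4 ^ˢ 2) ⊛ f 16 ^ˢ 2) ⊛ (θ₂ ⊛ f 8))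
    ≈⟨ +-cong (⊛-cong (≈-refl {f 1 ^ˢ 2}) (⊛-cong (≈-refl {f 8}) (≈-lower P≤4[1+N] (E₄.theta-eta N))))
              (⊛-cong (≈-refl {q}) (⊛-cong (≈-refl {(f 1 ^ˢ 2 ⊛ f 4 ^ˢ 2) ⊛ f 16 ^ˢ 2}) (≈-lower P≤4[1+N] (E₄.theta₂-eta N′)))) ⟩
  f 1 ^ˢ 2 ⊛ f 8 ^ˢ 6 +ˢ q ⊛ (((f 1 ^ˢ 2 ⊛ f 4 ^ˢ 2) ⊛ f 16 ^ˢ 2) ⊛ (ι (+ 2) ⊛ f 16 ^ˢ 2)) ∎
  where
  N  = suc N′
  K  = N +ℕ N
  P  = suc K
  θ  = E₁.theta K
  θ₄ = E₄.theta N
  θ₂ = E₄.theta₂ N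
  open Truncated P
  open ≈-Reasoning
  P≤4[1+N] : P ≤ 4 *ℕ suc N
  P≤4[1+N] = ℕ.≤-trans (ℕ.m≤m+n P (suc (suc P))) (ℕ.≤-reflexive (expand N))
    where
    expand : ∀ N → suc (N +ℕ N) +ℕ suc (suc (suc (N +ℕ N))) ≡ 4 *ℕ suc N
    expand = solve-∀

evenPart : Series
evenPart = (f 4 ^ˢ 6) ⊛ inv ((f 1 ^ˢ 4) ⊛ (f 8 ^ˢ 2))

oddPart : Series
oddPart = scale (+ 2) (((f 2 ^ˢ 2) ⊛ (f 8 ^ˢ 2)) ⊛ inv (f 1 ^ˢ 4))

dilate-evenPart : dilate evenPart ⊛ (f 2 ^ˢ 4 ⊛ f 16 ^ˢ 2) ≗ f 8 ^ˢ 6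
dilate-evenPart n = begin
  (dilate evenPart ⊛ (f 2 ^ˢ 4 ⊛ f 16 ^ˢ 2)) n
    ≡⟨ ⊛-congʳ (dilate evenPart) (λ m → sym (trans (dilate-⊛ (f 1 ^ˢ 4) (f 8 ^ˢ 2) m)
         (trans (⊛-congˡ (dilate (f 8 ^ˢ 2)) (dilate-f^ 1 4 (s≤s z≤n)) m) (⊛-congʳ (f 2 ^ˢ 4) (dilate-f^ 8 2 (s≤s z≤n)) m)))) n ⟩
  (dilate evenPart ⊛ dilate ((f 1 ^ˢ 4) ⊛ (f 8 ^ˢ 2))) n
    ≡⟨ dilate-⊛-inv (f 4 ^ˢ 6) ((f 1 ^ˢ 4) ⊛ (f 8 ^ˢ 2)) refl n ⟩
  dilate (f 4 ^ˢ 6) n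
    ≡⟨ dilate-f^ 4 6 (s≤s z≤n) n ⟩
  (f 8 ^ˢ 6) n ∎
  where open ≡-Reasoning

dilate-oddPart : dilate oddPart ⊛ f 2 ^ˢ 4 ≗ ι (+ 2) ⊛ (f 4 ^ˢ 2 ⊛ f 16 ^ˢ 2)
dilate-oddPart n = begin
  (dilate oddPart ⊛ f 2 ^ˢ 4) n
    ≡⟨ ⊛-congˡ (f 2 ^ˢ 4) (λ m → trans (dilate-scale (+ 2) O m) (sym (ι-⊛ (+ 2) (dilate O) m))) n ⟩
  ((ι (+ 2) ⊛ dilate O) ⊛ f 2 ^ˢ 4) n
    ≡⟨ ⊛-assoc (ι (+ 2)) (dilate O) (f 2 ^ˢ 4) n ⟩
  (ι (+ 2) ⊛ (dilate O ⊛ f 2 ^ˢ 4)) n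
    ≡⟨ ⊛-congʳ (ι (+ 2)) (λ m → trans (⊛-congʳ (dilate O) (λ k → sym (dilate-f^ 1 4 (s≤s z≤n) k)) m)
         (trans (dilate-⊛-inv ((f 2 ^ˢ 2) ⊛ (f 8 ^ˢ 2)) (f 1 ^ˢ 4) refl m)
           (trans (dilate-⊛ (f 2 ^ˢ 2) (f 8 ^ˢ 2) m)
             (trans (⊛-congˡ (dilate (f 8 ^ˢ 2)) (dilate-f^ 2 2 (s≤s z≤n)) m) (⊛-congʳ (f 4 ^ˢ 2) (dilate-f^ 8 2 (s≤s z≤n)) m))))) n ⟩
  (ι (+ 2) ⊛ (f 4 ^ˢ 2 ⊛ f 16 ^ˢ 2)) n ∎
  where
  open ≡-Reasoning
  O = ((f 2 ^ˢ 2) ⊛ (f 8 ^ˢ 2)) ⊛ inv (f 1 ^ˢ 4)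

Rgf8-dissection : Rgf 8 ≗ dilate evenPart +ˢ q ⊛ dilate oddPart
Rgf8-dissection n =
  ⊛-cancelʳ {M} {Rgf 8} {dilate evenPart +ˢ q ⊛ dilate oddPart} U refl (≈-trans Rgf8⊛U (≈-sym RHS⊛U)) n ℕ.≤-refl
  where
  M = suc n
  U = f 1 ^ˢ 2 ⊛ (f 2 ^ˢ 4 ⊛ f 16 ^ˢ 2)
  MR = f 1 ^ˢ 2 ⊛ f 8 ^ˢ 6 +ˢ q ⊛ (((f 1 ^ˢ 2 ⊛ f 4 ^ˢ 2) ⊛ f 16 ^ˢ 2) ⊛ (ι (+ 2) ⊛ f 16 ^ˢ 2))
  open Truncated M
  open ≈-Reasoning
  Rgf8⊛U : Rgf 8 ⊛ U ≈ MR
  Rgf8⊛U = begin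
    ((f 2 ⊛ f 8) ⊛ inv (f 1 ^ˢ 2)) ⊛ U
      ≈⟨ solve 5 (λ a b c e i → ((b :* c) :* i) :* ((a :^ 2) :* ((b :^ 4) :* (e :^ 2))) := (((b :^ 5) :* c) :* (e :^ 2)) :* (i :* (a :^ 2)))
           ≈-refl (f 1) (f 2) (f 8) (f 16) (inv (f 1 ^ˢ 2)) ⟩
    ((f 2 ^ˢ 5 ⊛ f 8) ⊛ f 16 ^ˢ 2) ⊛ (inv (f 1 ^ˢ 2) ⊛ f 1 ^ˢ 2)
      ≈⟨ ⊛-cong (≈-refl {(f 2 ^ˢ 5 ⊛ f 8) ⊛ f 16 ^ˢ 2}) (≗⇒≈ (⊛-inverseˡ (f 1 ^ˢ 2) refl)) ⟩
    ((f 2 ^ˢ 5 ⊛ f 8) ⊛ f 16 ^ˢ 2) ⊛ one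
      ≈⟨ ≗⇒≈ (⊛-identityʳ _) ⟩
    (f 2 ^ˢ 5 ⊛ f 8) ⊛ f 16 ^ˢ 2
      ≈⟨ ≈-lower (ℕ.≤-trans (ℕ.m≤m+n M (suc M)) (ℕ.≤-trans (ℕ.n≤1+n (M +ℕ suc M)) (ℕ.n≤1+n _))) (main-identity M) ⟩
    MR ∎
  RHS⊛U : (dilate evenPart +ˢ q ⊛ dilate oddPart) ⊛ U ≈ MR
  RHS⊛U = begin
    (dilate evenPart +ˢ q ⊛ dilate oddPart) ⊛ U
      ≈⟨ solve 6 (λ e x o a b c → (e :+ x :* o) :* ((a :^ 2) :* ((b :^ 4) :* (c :^ 2)))
                  := (a :^ 2) :* (e :* ((b :^ 4) :* (c :^ 2))) :+ x :* (((a :^ 2) :* (c :^ 2)) :* (o :* (b :^ 4))))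
           ≈-refl (dilate evenPart) q (dilate oddPart) (f 1) (f 2) (f 16) ⟩
    f 1 ^ˢ 2 ⊛ (dilate evenPart ⊛ (f 2 ^ˢ 4 ⊛ f 16 ^ˢ 2)) +ˢ q ⊛ ((f 1 ^ˢ 2 ⊛ f 16 ^ˢ 2) ⊛ (dilate oddPart ⊛ f 2 ^ˢ 4))
      ≈⟨ +-cong (⊛-cong (≈-refl {f 1 ^ˢ 2}) (≗⇒≈ dilate-evenPart))
                (⊛-cong (≈-refl {q}) (⊛-cong (≈-refl {f 1 ^ˢ 2 ⊛ f 16 ^ˢ 2}) (≗⇒≈ dilate-oddPart))) ⟩
    f 1 ^ˢ 2 ⊛ f 8 ^ˢ 6 +ˢ q ⊛ ((f 1 ^ˢ 2 ⊛ f 16 ^ˢ 2) ⊛ (ι (+ 2) ⊛ (f 4 ^ˢ 2 ⊛ f 16 ^ˢ 2)))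
      ≈⟨ +-cong (≈-refl {f 1 ^ˢ 2 ⊛ f 8 ^ˢ 6})
           (solve 5 (λ x a b c k → x :* ((a :* c) :* (k :* (b :* c))) := x :* (((a :* b) :* c) :* (k :* c)))
             ≈-refl q (f 1 ^ˢ 2) (f 4 ^ˢ 2) (f 16 ^ˢ 2) (ι (+ 2))) ⟩
    MR ∎

q⊛dilate-even : ∀ a n → (q ⊛ dilate a) (2 *ℕ n) ≡ + 0
q⊛dilate-even a zero    = refl
q⊛dilate-even a (suc n) =
  trans (cong (q ⊛ dilate a) (ℕ.*-suc 2 n)) (trans (q⊛-suc (dilate a) (suc (2 *ℕ n))) (dilate-odd a n))

q⊛dilate-odd : ∀ a n → (q ⊛ dilate a) (suc (2 *ℕ n)) ≡ a n
q⊛dilate-odd a n = trans (q⊛-suc (dilate a) (2 *ℕ n)) (dilate-even a n)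

lemma2p2 : (∀ (n : ℕ) → Rbar 8 (2 *ℕ n) ≡ ((f 4 ^ˢ 6) ⊛ inv ((f 1 ^ˢ 4) ⊛ (f 8 ^ˢ 2))) n)
         × (∀ (n : ℕ) → Rbar 8 (suc (2 *ℕ n)) ≡ scale (+ 2) (((f 2 ^ˢ 2) ⊛ (f 8 ^ˢ 2)) ⊛ inv (f 1 ^ˢ 4)) n)
lemma2p2 = even , odd
  where
  even : ∀ n → Rbar 8 (2 *ℕ n) ≡ evenPart n
  even n = trans (Rgf8-dissection (2 *ℕ n))
    (trans (cong₂ _+_ (dilate-even evenPart n) (q⊛dilate-even oddPart n)) (ℤ.+-identityʳ (evenPart n)))
  odd : ∀ n → Rbar 8 (suc (2 *ℕ n)) ≡ oddPart n
  odd n = trans (Rgf8-dissection (suc (2 *ℕ n)))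
    (trans (cong₂ _+_ (dilate-odd evenPart n) (q⊛dilate-odd oddPart n)) (ℤ.+-identityˡ (oddPart n)))
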